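{- Let $n\geq 2$ be an integer and let $M$ be an $n$-connected binary matroid with $|E(M)|\geq 2n-2$. Suppose $T\subset E(M)$ with $|T|=n-1$. Then the following are equivalent: (i) $M'_T$ is $n$-connected; (ii) $|Q|\geq 2|Q\cap T|$ for every cocircuit $Q$ of $M$ with $Q\cap T\neq\emptyset$; (iii) for every subset $A\subset E(M)$ with $|A|=n-2$, there exists a circuit $C$ of $M$ with $|C\cap T|$ odd and $C\subseteq E(M)-A$.
   Context: Element splitting: let $M$ be a binary matroid with standard matrix representation $A$ over $GF(2)$ and $T\subseteq E(M)$. Let $A'_T$ be the matrix obtained from $A$ by adjoining an extra row whose entries are $1$ in the columns labelled by elements of $T$ and $0$ otherwise, and then adjoining an extra column labelled by a new element $a$ with $1$ in the last row and $0$ elsewhere. $M'_T$ denotes the vector matroid of $A'_T$. A matroid is $n$-connected if it has no $k$-separation for any $k<n$, where a $k$-separation of a matroid $N$ with rank function $r$ is a partition $(X,Y)$ of $E(N)$ with $\min\{|X|,|Y|\}\geq k$ and $r(X)+r(Y)-r(E(N))\leq k-1$. -}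

module Defs where

open import Data.Nat using (ℕ; zero; suc; _+_; _*_; _≤_; _<_; _%_)
open import Data.Bool using (Bool; true; false; _∧_; _xor_)
open import Data.Fin using (Fin; zero; suc; splitAt; _≟_)
open import Data.Fin.Subset using (Subset; _⊆_; ∁; ∣_∣; Empty; ⊤; _∩_)
open import Data.Vec using (Vec; []; _∷_)
open import Data.Sum using (inj₁; inj₂)
open import Data.Product using (Σ; ∃; _×_; _,_)
open import Relation.Nullary using (¬_)
open import Relation.Nullary.Decidable using (isYes)
open import Relation.Binary.PropositionalEquality using (_≡_)

-- A matrix over GF(2) (= Bool with xor/∧) with r rows and m columns,
-- given column-wise: A j i is the entry in row i, column j.
BMatrix : ℕ → ℕ → Set
BMatrix r m = Fin m → Fin r → Bool

sumCols : ∀ {r m} → BMatrix r m → Subset m → Fin r → Bool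
sumCols {m = zero}  A []      i = false
sumCols {m = suc m} A (b ∷ Y) i = (b ∧ A zero i) xor sumCols (λ j → A (suc j)) Y i

-- The vector matroid M[A] on ground set Fin m.
-- X is independent iff the columns in X are linearly independent over GF(2),
-- i.e. no nonempty subset of X has column sum zero.
Independent : ∀ {r m} → BMatrix r m → Subset m → Set
Independent A X = ∀ Y → Y ⊆ X → (∀ i → sumCols A Y i ≡ false) → Empty Y

Dependent : ∀ {r m} → BMatrix r m → Subset m → Set
Dependent A X = ¬ Independent A X

HasRank : ∀ {r m} → BMatrix r m → Subset m → ℕ → Set
HasRank A X k =
  (Σ (Subset _) λ I → I ⊆ X × Independent A I × ∣ I ∣ ≡ k) ×
  (∀ I → I ⊆ X → Independent A I → ∣ I ∣ ≤ k)

Basis : ∀ {r m} → BMatrix r m → Subset m → Set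
Basis A B = Independent A B × (∀ J → B ⊆ J → Independent A J → J ≡ B)

Circuit : ∀ {r m} → BMatrix r m → Subset m → Set
Circuit A C = Dependent A C × (∀ D → D ⊆ C → Dependent A D → D ≡ C)

-- dual matroid M*: its bases are the complements of bases of M, so a set is
-- independent in M* iff it is contained in the complement of some basis of M.
CoIndependent : ∀ {r m} → BMatrix r m → Subset m → Set
CoIndependent A X = ∃ λ B → Basis A B × X ⊆ ∁ B

CoDependent : ∀ {r m} → BMatrix r m → Subset m → Set
CoDependent A X = ¬ CoIndependent A X

-- cocircuits of M = circuits of M*
Cocircuit : ∀ {r m} → BMatrix r m → Subset m → Set
Cocircuit A Q = CoDependent A Q × (∀ D → D ⊆ Q → CoDependent A D → D ≡ Q)

-- (X, E - X) is a k-separation of M[A]: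
-- min{|X|,|Y|} ≥ k and r(X) + r(Y) - r(E) ≤ k - 1 (written r(X)+r(Y)+1 ≤ r(E)+k).
Separation : ∀ {r m} → BMatrix r m → ℕ → Subset m → Set
Separation A k X =
  k ≤ ∣ X ∣ × k ≤ ∣ ∁ X ∣ ×
  (∃ λ rX → ∃ λ rY → ∃ λ rE →
     HasRank A X rX × HasRank A (∁ X) rY × HasRank A ⊤ rE ×
     rX + rY + 1 ≤ rE + k)

NConnected : ∀ {r m} → ℕ → BMatrix r m → Set
NConnected n A = ∀ k → k < n → ∀ X → ¬ Separation A k X

-- standard matrix representation [I_r | D] over GF(2), ground set Fin (r + k)
stdMatrix : ∀ {r k} → (Fin r → Fin k → Bool) → BMatrix r (r + k)
stdMatrix {r} D j with splitAt r j
... | inj₁ c = λ i → isYes (c ≟ i)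
... | inj₂ l = λ i → D i l

-- element splitting A'_T: new row (index zero) is the indicator of T,
-- new column (index zero, the element a) is the unit vector of the new row.
splitMatrix : ∀ {r m} → BMatrix r m → Subset m → BMatrix (suc r) (suc m)
splitMatrix A T zero    zero    = true
splitMatrix A T zero    (suc i) = false
splitMatrix A T (suc j) zero    = Data.Vec.lookup T j
splitMatrix A T (suc j) (suc i) = A j i

Odd : ℕ → Set
Odd k = k % 2 ≡ 1

module Submission where

-- The proof is linear algebra over GF(2) for an arbitrary binary matrix A.
-- A cycle is a set of columns summing to zero; X is dependent iff it contains
-- a nonempty cycle, and the cycles of M′ are the sets Y, plus the new element
-- a when ∣ Y ∩ T ∣ is odd, for Y a cycle of M.  A cocycle meets every cycle
-- evenly.
-- With n = p + 2: (i) ⇔ (iii) compares ranks in M′ and M, the only new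
-- separations being (a + B, E − B) with ∣ B ∣ = p and no T-odd cycle in
-- E − B; (ii) ⇔ (iii) since (ii) fails iff a cocycle agrees with T outside
-- some p-set B, iff E − B has no T-odd cycle.

open import Defs
open import Algebra.Bundles using (CommutativeRing)
open import Data.Bool using (Bool; true; false; _∧_; _∨_; _xor_; not)
import Data.Bool.Properties as BoolP
open import Algebra.Properties.CommutativeSemigroup
  (CommutativeRing.+-commutativeSemigroup BoolP.xor-∧-commutativeRing) using (interchange)
open import Data.Empty using (⊥-elim) renaming (⊥ to False)
open import Data.Fin using (Fin; zero; suc)
import Data.Fin.Properties as FinP
open import Data.Fin.Subset
open import Data.Fin.Subset.Properties
  using (_∈?_; _⊆?_; _⊂?_; nonempty?; anySubset?; ∉⊥; ⊥⊆; ⊆⊤; ⊆-refl; ⊆-trans; ⊆-antisym;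
         drop-∷-⊆; s⊆s; out⊆; x∈⁅x⁆; x∈⁅y⁆⇒x≡y; x≢y⇒x∉⁅y⁆; x∈p∩q⁻; Empty-unique; ∩-comm;
         ∩-zeroʳ; ∪-identityʳ; ∣⊥∣≡0; ∣p∣≤n; ∣∁p∣≡n∸∣p∣; p⊆q⇒∣p∣≤∣q∣; p⊂q⇒∣p∣<∣q∣; p⊆q⇒∁p⊇∁q)
open import Data.Nat using (ℕ; zero; suc; _+_; _*_; _∸_; _≤_; _<_; z≤n; s≤s)
open import Data.Nat.Properties
  using (_≤?_; _<?_; ≤-refl; ≤-trans; ≤-antisym; ≤-pred; ≤-<-trans; <-≤-trans; <-irrefl; ≮⇒≥; ≰⇒>;
         <⇒≱; n≤1+n; m≤m+n; m+n≤o⇒n≤o; m+n≤o⇒m≤o∸n; +-comm; +-assoc; +-suc; +-identityʳ;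
         +-mono-≤; +-monoˡ-≤; +-monoʳ-≤; +-monoˡ-<; +-monoʳ-<; +-cancelʳ-≤; +-cancelˡ-<; +-cancelʳ-<;
         module ≤-Reasoning)
open import Data.Nat.Solver using (module +-*-Solver)
open +-*-Solver using (solve; _:+_; _:=_; con)
open import Data.Product using (∃; _×_; _,_; proj₁; proj₂)
open import Data.Sum using (_⊎_; inj₁; inj₂)
open import Data.Vec using ([]; _∷_; lookup; zipWith; tabulate; here; there)
open import Data.Vec.Properties
  using (≡-dec; []=⇒lookup; lookup⇒[]=; lookup-zipWith; lookup-map; lookup-replicate; lookup∘tabulate)
open import Function using (_∘_)
open import Function.Bundles using (_⇔_; mk⇔; Equivalence)
open import Relation.Binary.PropositionalEquality
  using (_≡_; _≢_; refl; sym; trans; cong; cong₂; subst; subst₂; module ≡-Reasoning)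
open import Relation.Nullary using (¬_; Dec; yes; no; ¬?)
open import Relation.Nullary.Decidable using (map′; _×-dec_; _→-dec_; decidable-stable)

private
  variable
    m : ℕ
    p q : Subset m
    x y : Fin m

infixl 9 _!_
infixr 6 _⊕_

_!_ : Subset m → Fin m → Bool
p ! x = lookup p x

_⊕_ : Subset m → Subset m → Subset m
p ⊕ q = zipWith _xor_ p q

clash : ∀ {ℓ} {A : Set ℓ} {b : Bool} → b ≡ true → b ≡ false → A
clash refl ()

xor≡false⇒≡ : ∀ {a b} → (a xor b) ≡ false → a ≡ b
xor≡false⇒≡ {true}  {true}  _ = refl
xor≡false⇒≡ {false} {false} _ = refl

∈⇒! : x ∈ p → p ! x ≡ true
∈⇒! = []=⇒lookup

!⇒∈ : p ! x ≡ true → x ∈ p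
!⇒∈ {p = p} {x} = lookup⇒[]= x p

!⇒∉ : p ! x ≡ false → x ∉ p
!⇒∉ px x∈p = clash (∈⇒! x∈p) px

∉⇒! : x ∉ p → p ! x ≡ false
∉⇒! {x = x} {p} x∉p with p ! x in px
... | true  = ⊥-elim (x∉p (!⇒∈ px))
... | false = refl

⊆I : (∀ x → p ! x ≡ true → q ! x ≡ true) → p ⊆ q
⊆I h {x} x∈p = !⇒∈ (h x (∈⇒! x∈p))

⊆E : p ⊆ q → ∀ x → p ! x ≡ true → q ! x ≡ true
⊆E p⊆q x px = ∈⇒! (p⊆q (!⇒∈ px))

subset-ext : (∀ x → p ! x ≡ q ! x) → p ≡ q
subset-ext {p = []}    {[]}    h = refl
subset-ext {p = a ∷ p} {b ∷ q} h = cong₂ _∷_ (h zero) (subset-ext (λ x → h (suc x)))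

!∩ : ∀ (p q : Subset m) x → (p ∩ q) ! x ≡ (p ! x ∧ q ! x)
!∩ p q x = lookup-zipWith _∧_ x p q

!∪ : ∀ (p q : Subset m) x → (p ∪ q) ! x ≡ (p ! x ∨ q ! x)
!∪ p q x = lookup-zipWith _∨_ x p q

!⊕ : ∀ (p q : Subset m) x → (p ⊕ q) ! x ≡ (p ! x xor q ! x)
!⊕ p q x = lookup-zipWith _xor_ x p q

!∁ : ∀ (p : Subset m) x → ∁ p ! x ≡ not (p ! x)
!∁ p x = lookup-map x not p

!⊥ : ∀ (x : Fin m) → ⊥ ! x ≡ false
!⊥ x = lookup-replicate x false

!⁅⁆-same : ∀ (x : Fin m) → ⁅ x ⁆ ! x ≡ true
!⁅⁆-same x = ∈⇒! (x∈⁅x⁆ x)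

!⁅⁆-diff : x ≢ y → ⁅ y ⁆ ! x ≡ false
!⁅⁆-diff x≢y = ∉⇒! (x≢y⇒x∉⁅y⁆ x≢y)

!⁅⁆⁻ : ⁅ y ⁆ ! x ≡ true → x ≡ y
!⁅⁆⁻ {y = y} e = x∈⁅y⁆⇒x≡y y (!⇒∈ e)

∩⁺ : ∀ (p q : Subset m) x → p ! x ≡ true → q ! x ≡ true → (p ∩ q) ! x ≡ true
∩⁺ p q x px qx rewrite !∩ p q x | px | qx = refl

∩⁻ : ∀ (p q : Subset m) x → (p ∩ q) ! x ≡ true → p ! x ≡ true × q ! x ≡ true
∩⁻ p q x e rewrite !∩ p q x with p ! x | q ! x
... | true  | true  = refl , refl
... | true  | false = clash e refl
... | false | _     = clash e refl

∪⁺ˡ : ∀ (p q : Subset m) x → p ! x ≡ true → (p ∪ q) ! x ≡ true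
∪⁺ˡ p q x px rewrite !∪ p q x | px = refl

∪⁺ʳ : ∀ (p q : Subset m) x → q ! x ≡ true → (p ∪ q) ! x ≡ true
∪⁺ʳ p q x qx rewrite !∪ p q x | qx = BoolP.∨-zeroʳ (p ! x)

∪⁻ : ∀ (p q : Subset m) x → (p ∪ q) ! x ≡ true → p ! x ≡ true ⊎ q ! x ≡ true
∪⁻ p q x e rewrite !∪ p q x with p ! x
... | true  = inj₁ refl
... | false = inj₂ e

∁⁺ : ∀ (p : Subset m) x → p ! x ≡ false → ∁ p ! x ≡ true
∁⁺ p x px rewrite !∁ p x | px = refl

∁⁻ : ∀ (p : Subset m) x → ∁ p ! x ≡ true → p ! x ≡ false
∁⁻ p x e rewrite !∁ p x with p ! x
... | true  = clash e refl
... | false = refl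

⊕⁺ˡ : ∀ (p q : Subset m) x → p ! x ≡ true → q ! x ≡ false → (p ⊕ q) ! x ≡ true
⊕⁺ˡ p q x px qx rewrite !⊕ p q x | px | qx = refl

⊕⁻ : ∀ (p q : Subset m) x → (p ⊕ q) ! x ≡ true →
     (p ! x ≡ true × q ! x ≡ false) ⊎ (p ! x ≡ false × q ! x ≡ true)
⊕⁻ p q x e rewrite !⊕ p q x with p ! x | q ! x
... | true  | false = inj₁ (refl , refl)
... | false | true  = inj₂ (refl , refl)
... | true  | true  = clash e refl
... | false | false = clash e refl

⊕⁺ʳ : ∀ (p q : Subset m) x → p ! x ≡ false → q ! x ≡ true → (p ⊕ q) ! x ≡ true
⊕⁺ʳ p q x px qx rewrite !⊕ p q x | px | qx = refl

⊕-same : ∀ (p q : Subset m) x → p ! x ≡ q ! x → (p ⊕ q) ! x ≡ false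
⊕-same p q x e rewrite !⊕ p q x | e = BoolP.xor-same (q ! x)

infixl 5 _∖_

_∖_ : Subset m → Fin m → Subset m
p ∖ y = p ∩ ∁ ⁅ y ⁆

∖⁺ : ∀ (p : Subset m) y x → p ! x ≡ true → x ≢ y → (p ∖ y) ! x ≡ true
∖⁺ p y x px x≢y = ∩⁺ p (∁ ⁅ y ⁆) x px (∁⁺ ⁅ y ⁆ x (!⁅⁆-diff x≢y))

∖⁻ : ∀ (p : Subset m) y x → (p ∖ y) ! x ≡ true → p ! x ≡ true × x ≢ y
∖⁻ p y x e with ∩⁻ p (∁ ⁅ y ⁆ ) x e
... | px , yx = px , λ { refl → clash (!⁅⁆-same x) (∁⁻ ⁅ y ⁆ x yx) }

∖-same : ∀ (p : Subset m) x → (p ∖ x) ! x ≡ false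
∖-same p x rewrite !∩ p (∁ ⁅ x ⁆) x | !∁ ⁅ x ⁆ x | !⁅⁆-same x = BoolP.∧-zeroʳ (p ! x)

nonempty-! : p ! x ≡ true → Nonempty p
nonempty-! {x = x} px = x , !⇒∈ px

nonempty-tail : Nonempty (false ∷ p) → Nonempty p
nonempty-tail (suc x , there x∈p) = x , x∈p

¬nonempty-⊥ : ¬ Nonempty (⊥ {m})
¬nonempty-⊥ (_ , x∈⊥) = ∉⊥ x∈⊥

∪⁅⁆⁻ : ∀ (p : Subset m) y x → (p ∪ ⁅ y ⁆) ! x ≡ true → p ! x ≡ true ⊎ x ≡ y
∪⁅⁆⁻ p y x e with ∪⁻ p ⁅ y ⁆ x e
... | inj₁ px = inj₁ px
... | inj₂ yx = inj₂ (!⁅⁆⁻ yx)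

∈-∪⁅⁆ : ∀ (p : Subset m) x → (p ∪ ⁅ x ⁆) ! x ≡ true
∈-∪⁅⁆ p x = ∪⁺ʳ p ⁅ x ⁆ x (!⁅⁆-same x)

⊆-∪⁅⁆ : ∀ (p : Subset m) x → p ⊆ p ∪ ⁅ x ⁆
⊆-∪⁅⁆ p x = ⊆I (λ u → ∪⁺ˡ p ⁅ x ⁆ u)

∪⁅⁆-⊆ : p ⊆ q → q ! x ≡ true → p ∪ ⁅ x ⁆ ⊆ q
∪⁅⁆-⊆ {p = p} {q} {x} p⊆q qx = ⊆I λ u e → case-∪⁅⁆ (∪⁅⁆⁻ p x u e)
  where
  case-∪⁅⁆ : ∀ {u} → p ! u ≡ true ⊎ u ≡ x → q ! u ≡ true
  case-∪⁅⁆ {u} (inj₁ pu)  = ⊆E p⊆q u pu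
  case-∪⁅⁆     (inj₂ refl) = qx

⊆-∪⁅⁆-avoid : ∀ {Z} → Z ⊆ p ∪ ⁅ x ⁆ → Z ! x ≡ false → Z ⊆ p
⊆-∪⁅⁆-avoid {p = p} {x} {Z} Z⊆ Zx = ⊆I λ u Zu → case-∪⁅⁆ u Zu (∪⁅⁆⁻ p x u (⊆E Z⊆ u Zu))
  where
  case-∪⁅⁆ : ∀ u → Z ! u ≡ true → p ! u ≡ true ⊎ u ≡ x → p ! u ≡ true
  case-∪⁅⁆ u Zu (inj₁ pu)  = pu
  case-∪⁅⁆ u Zu (inj₂ refl) = clash Zu Zx

⊕-⊆ : ∀ {Y} → p ⊆ Y → q ⊆ Y → p ⊕ q ⊆ Y
⊕-⊆ {p = p} {q} {Y} p⊆Y q⊆Y = ⊆I λ u e → case-⊕ u (⊕⁻ p q u e)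
  where
  case-⊕ : ∀ u → (p ! u ≡ true × q ! u ≡ false) ⊎ (p ! u ≡ false × q ! u ≡ true) → Y ! u ≡ true
  case-⊕ u (inj₁ (pu , _)) = ⊆E p⊆Y u pu
  case-⊕ u (inj₂ (_ , qu)) = ⊆E q⊆Y u qu

outside-empty : ∀ {W I : Subset m} → ¬ Nonempty (W ∩ ∁ I) → W ⊆ I
outside-empty {W = W} {I} none = ⊆I λ u Wu → decidable-stable (I ! u BoolP.≟ true)
  λ Iu → none (nonempty-! (∩⁺ W (∁ I) u Wu (∁⁺ I u (BoolP.¬-not Iu))))

⊕-shrinks-outside : ∀ {I : Subset m} W Z {c} → W ! c ≡ true → I ! c ≡ false → Z ⊆ I ∪ ⁅ c ⁆ →
                    Z ! c ≡ true → (W ⊕ Z) ∩ ∁ I ⊂ W ∩ ∁ I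
⊕-shrinks-outside {I = I} W Z {c} Wc Ic Z⊆ Zc =
  ⊆I (λ u e → kept u (∩⁻ (W ⊕ Z) (∁ I) u e)) , c ,
  !⇒∈ (∩⁺ W (∁ I) c Wc (∁⁺ I c Ic)) ,
  !⇒∉ (trans (!∩ (W ⊕ Z) (∁ I) c) (cong (_∧ ∁ I ! c) (⊕-same W Z c (trans Wc (sym Zc)))))
  where
  kept : ∀ u → (W ⊕ Z) ! u ≡ true × ∁ I ! u ≡ true → (W ∩ ∁ I) ! u ≡ true
  kept u (e , I′u) with ⊕⁻ W Z u e
  ... | inj₁ (Wu , _) = ∩⁺ W (∁ I) u Wu I′u
  ... | inj₂ (Wu , Zu) with ∪⁅⁆⁻ I c u (⊆E Z⊆ u Zu)
  ...   | inj₁ Iu   = clash Iu (∁⁻ I u I′u)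
  ...   | inj₂ refl = clash Wc Wu

⊕≡⊥⇒≡ : p ⊕ q ≡ ⊥ → p ≡ q
⊕≡⊥⇒≡ {p = p} {q} e = subset-ext λ x →
  xor≡false⇒≡ (trans (sym (!⊕ p q x)) (trans (cong (_! x) e) (!⊥ x)))

∁-involutive : ∀ (X : Subset m) → ∁ (∁ X) ≡ X
∁-involutive X = subset-ext λ u → trans (!∁ (∁ X) u) (trans (cong not (!∁ X u)) (BoolP.not-involutive (X ! u)))

card-split : ∀ (X U : Subset m) → ∣ X ∣ ≡ ∣ X ∩ U ∣ + ∣ X ∩ ∁ U ∣
card-split []          []          = refl
card-split (true ∷ X)  (true ∷ U)  = cong suc (card-split X U)
card-split (true ∷ X)  (false ∷ U) = trans (cong suc (card-split X U)) (sym (+-suc _ _))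
card-split (false ∷ X) (_ ∷ U)     = card-split X U

card-⊕ : ∀ (X Y : Subset m) → ∣ X ⊕ Y ∣ ≡ ∣ X ∩ ∁ Y ∣ + ∣ Y ∩ ∁ X ∣
card-⊕ []          []          = refl
card-⊕ (true ∷ X)  (true ∷ Y)  = card-⊕ X Y
card-⊕ (true ∷ X)  (false ∷ Y) = cong suc (card-⊕ X Y)
card-⊕ (false ∷ X) (true ∷ Y)  = trans (cong suc (card-⊕ X Y)) (sym (+-suc _ _))
card-⊕ (false ∷ X) (false ∷ Y) = card-⊕ X Y

card-⊆-⊕ : ∀ {Q G : Subset m} → Q ⊆ G → ∀ U → ∣ G ∩ U ∣ ≡ ∣ Q ∩ U ∣ + ∣ (G ⊕ Q) ∩ U ∣
card-⊆-⊕ {Q = []}        {[]}        _   []          = refl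
card-⊆-⊕ {Q = true ∷ Q}  {true ∷ G}  Q⊆G (true ∷ U)  = cong suc (card-⊆-⊕ (drop-∷-⊆ Q⊆G) U)
card-⊆-⊕ {Q = true ∷ Q}  {true ∷ G}  Q⊆G (false ∷ U) = card-⊆-⊕ (drop-∷-⊆ Q⊆G) U
card-⊆-⊕ {Q = true ∷ Q}  {false ∷ G} Q⊆G U           = clash (∈⇒! (Q⊆G here)) refl
card-⊆-⊕ {Q = false ∷ Q} {true ∷ G}  Q⊆G (true ∷ U)  =
  trans (cong suc (card-⊆-⊕ (drop-∷-⊆ Q⊆G) U)) (sym (+-suc _ _))
card-⊆-⊕ {Q = false ∷ Q} {true ∷ G}  Q⊆G (false ∷ U) = card-⊆-⊕ (drop-∷-⊆ Q⊆G) U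
card-⊆-⊕ {Q = false ∷ Q} {false ∷ G} Q⊆G (_ ∷ U)     = card-⊆-⊕ (drop-∷-⊆ Q⊆G) U

card-∷ : ∀ b (p : Subset m) → ∣ b ∷ p ∣ ≤ suc ∣ p ∣
card-∷ true  p = ≤-refl
card-∷ false p = n≤1+n ∣ p ∣

card-insert : ∀ (p : Subset m) x → p ! x ≡ false → ∣ p ∪ ⁅ x ⁆ ∣ ≡ suc ∣ p ∣
card-insert (false ∷ p) zero    _  = cong (suc ∘ ∣_∣) (∪-identityʳ p)
card-insert (true ∷ p)  (suc x) px = cong suc (card-insert p x px)
card-insert (false ∷ p) (suc x) px = card-insert p x px

card-remove : ∀ (p : Subset m) x → p ! x ≡ true → ∣ p ∣ ≡ suc ∣ p ∖ x ∣
card-remove (true ∷ p)  zero    _  = cong (suc ∘ ∣_∣) (sym nothing-removed)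
  where
  nothing-removed : p ∩ ∁ ⊥ ≡ p
  nothing-removed = subset-ext λ x →
    trans (!∩ p (∁ ⊥) x) (trans (cong (p ! x ∧_) (trans (!∁ ⊥ x) (cong not (!⊥ x)))) (BoolP.∧-identityʳ (p ! x)))
card-remove (true ∷ p)  (suc x) px = cong suc (card-remove p x px)
card-remove (false ∷ p) (suc x) px = card-remove p x px

enlarge : ∀ (X : Subset m) s → ∣ X ∣ ≤ s → s ≤ m → ∃ λ B → X ⊆ B × ∣ B ∣ ≡ s
enlarge []          zero    _        _        = [] , (λ ()) , refl
enlarge (true ∷ X)  (suc s) (s≤s le) (s≤s s≤m) with enlarge X s le s≤m
... | B , X⊆B , ∣B∣ = true ∷ B , s⊆s X⊆B , cong suc ∣B∣
enlarge {suc m} (false ∷ X) s le s≤1+m with s ≤? m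
... | yes s≤m with enlarge X s le s≤m
...   | B , X⊆B , ∣B∣ = false ∷ B , out⊆ X⊆B , ∣B∣
enlarge {suc m} (false ∷ X) zero    le z≤n       | no s≰m = ⊥-elim (s≰m z≤n)
enlarge {suc m} (false ∷ X) (suc s) le (s≤s s≤m) | no s≰m
  with enlarge X s (≤-trans (∣p∣≤n X) (≤-pred (≰⇒> s≰m))) s≤m
... | B , X⊆B , ∣B∣ = true ∷ B , out⊆ X⊆B , cong suc ∣B∣

positive⇒nonempty : ∀ (p : Subset m) → 0 < ∣ p ∣ → Nonempty p
positive⇒nonempty {m} p pos with nonempty? p
... | yes nep = nep
... | no  p∅  = ⊥-elim (<-irrefl (sym (∣⊥∣≡0 m)) (subst (λ S → 0 < ∣ S ∣) (Empty-unique p∅) pos))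

Majority : Subset m → Subset m → Set
Majority T Q = ∣ Q ∩ ∁ T ∣ < ∣ Q ∩ T ∣

majority⇔half : ∀ (T Q : Subset m) → Majority T Q ⇔ ∣ Q ∣ < 2 * ∣ Q ∩ T ∣
majority⇔half T Q = mk⇔
  (λ maj → subst₂ _<_ (sym (card-split Q T)) twice (+-monoʳ-< ∣ Q ∩ T ∣ maj))
  (λ half → +-cancelˡ-< ∣ Q ∩ T ∣ _ _ (subst₂ _<_ (card-split Q T) (sym twice) half))
  where
  twice : ∣ Q ∩ T ∣ + ∣ Q ∩ T ∣ ≡ 2 * ∣ Q ∩ T ∣
  twice = cong (∣ Q ∩ T ∣ +_) (sym (+-identityʳ ∣ Q ∩ T ∣))

-- For ∣ T ∣ = p + 1, Q is T-majority iff Q differs from T in at most p elements: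
-- both say ∣ Q − T ∣ + ∣ T − Q ∣ < ∣ Q ∩ T ∣ + ∣ T − Q ∣ = p + 1.
majority⇔close : ∀ {p} (T Q : Subset m) → ∣ T ∣ ≡ suc p → Majority T Q ⇔ ∣ Q ⊕ T ∣ ≤ p
majority⇔close {p = p} T Q ∣T∣ = mk⇔
  (λ maj → ≤-pred (subst₂ _<_ (sym (card-⊕ Q T)) T-size (+-monoˡ-< ∣ T ∩ ∁ Q ∣ maj)))
  (λ close → +-cancelʳ-< ∣ T ∩ ∁ Q ∣ _ _ (subst₂ _<_ (card-⊕ Q T) (sym T-size) (s≤s close)))
  where
  T-size : ∣ Q ∩ T ∣ + ∣ T ∩ ∁ Q ∣ ≡ suc p
  T-size = trans (cong (_+ ∣ T ∩ ∁ Q ∣) (cong ∣_∣ (∩-comm Q T))) (trans (sym (card-split T Q)) ∣T∣)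

⊆-¬⊂⇒≡ : p ⊆ q → ¬ (p ⊂ q) → p ≡ q
⊆-¬⊂⇒≡ {p = p} {q} p⊆q p⊄q with q ⊆? p
... | yes q⊆p = ⊆-antisym p⊆q q⊆p
... | no  q⊈p with FinP.any? (λ x → x ∈? q ×-dec ¬? (x ∈? p))
...   | yes (x , x∈q , x∉p) = ⊥-elim (p⊄q (p⊆q , x , x∈q , x∉p))
...   | no  none = ⊥-elim (q⊈p (λ {x} x∈q → decidable-stable (x ∈? p) (λ x∉p → none (x , x∈q , x∉p))))

minimal : ∀ {P : Subset m → Set} → (∀ p → Dec (P p)) → ∀ X → P X →
          ∃ λ Y → Y ⊆ X × P Y × (∀ Z → Z ⊆ Y → P Z → Z ≡ Y)
minimal {P = P} P? X PX = descend (suc ∣ X ∣) X ≤-refl PX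
  where
  descend : ∀ fuel X → ∣ X ∣ < fuel → P X → ∃ λ Y → Y ⊆ X × P Y × (∀ Z → Z ⊆ Y → P Z → Z ≡ Y)
  descend (suc fuel) X lt PX with anySubset? (λ Z → Z ⊂? X ×-dec P? Z)
  ... | yes (Z , Z⊂X , PZ) with descend fuel Z (≤-trans (p⊂q⇒∣p∣<∣q∣ Z⊂X) (≤-pred lt)) PZ
  ...   | Y , Y⊆Z , PY , min = Y , ⊆-trans Y⊆Z (proj₁ Z⊂X) , PY , min
  descend (suc fuel) X lt PX | no none =
    X , ⊆-refl , PX , λ Z Z⊆X PZ → ⊆-¬⊂⇒≡ Z⊆X (λ Z⊂X → none (Z , Z⊂X , PZ))

largest : ∀ {P : Subset m → Set} → (∀ p → Dec (P p)) → ∃ P → ∃ λ I → P I × (∀ J → P J → ∣ J ∣ ≤ ∣ I ∣)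
largest {m} {P} P? (I₀ , PI₀) = ascend (suc m) 0 (I₀ , PI₀ , z≤n) (λ { (I , _ , le) → too-big I le })
  where
  AtLeast : ℕ → Set
  AtLeast s = ∃ λ I → P I × s ≤ ∣ I ∣
  too-big : ∀ I → suc m + 0 ≤ ∣ I ∣ → False
  too-big I le = <-irrefl refl (≤-trans (subst (_≤ ∣ I ∣) (+-identityʳ (suc m)) le) (∣p∣≤n I))
  ascend : ∀ d s → AtLeast s → ¬ AtLeast (d + s) → ∃ λ I → P I × (∀ J → P J → ∣ J ∣ ≤ ∣ I ∣)
  ascend zero    s q nq = ⊥-elim (nq q)
  ascend (suc d) s (I , PI , s≤I) nq with anySubset? (λ J → P? J ×-dec (suc s ≤? ∣ J ∣))
  ... | yes q′ = ascend d (suc s) q′ (subst (λ t → ¬ AtLeast t) (sym (+-suc d s)) nq)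
  ... | no nq′ = I , PI , λ J PJ → ≤-trans (≮⇒≥ (λ s<J → nq′ (J , PJ , s<J))) s≤I

-- Column sums over GF(2): cycles, and the parity pairing of two subsets.

private
  variable
    r : ℕ
    A : BMatrix r m

∧-xor-regroup : ∀ a b c s t → ((a xor b) ∧ c) xor (s xor t) ≡ ((a ∧ c) xor s) xor ((b ∧ c) xor t)
∧-xor-regroup a b c s t =
  trans (cong (_xor (s xor t)) (BoolP.∧-distribʳ-xor c a b)) (interchange (a ∧ c) (b ∧ c) s t)

sumCols-⊕ : ∀ (A : BMatrix r m) (p q : Subset m) i →
            sumCols A (p ⊕ q) i ≡ (sumCols A p i xor sumCols A q i)
sumCols-⊕ {m = zero}  A []      []      i = refl
sumCols-⊕ {m = suc m} A (a ∷ p) (b ∷ q) i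
  rewrite sumCols-⊕ (λ j → A (suc j)) p q i = ∧-xor-regroup a b (A zero i) _ _

sumCols-rows : ∀ {r′} (A : BMatrix r m) (A′ : BMatrix r′ m) i i′ → (∀ j → A j i ≡ A′ j i′) →
               ∀ Y → sumCols A Y i ≡ sumCols A′ Y i′
sumCols-rows {m = zero}  A A′ i i′ same []      = refl
sumCols-rows {m = suc m} A A′ i i′ same (y ∷ Y)
  rewrite same zero | sumCols-rows (λ j → A (suc j)) (λ j → A′ (suc j)) i i′ (λ j → same (suc j)) Y = refl

-- A cycle of M[A] is a set of columns summing to zero (a disjoint union of circuits).
record Cycle (A : BMatrix r m) (Z : Subset m) : Set where
  constructor cycle
  field sums-to-zero : ∀ i → sumCols A Z i ≡ false

open Cycle

cycle? : ∀ (A : BMatrix r m) Z → Dec (Cycle A Z)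
cycle? A Z = map′ cycle sums-to-zero (FinP.all? (λ i → sumCols A Z i BoolP.≟ false))

cycle-⊕ : Cycle A p → Cycle A q → Cycle A (p ⊕ q)
cycle-⊕ {A = A} {p} {q} (cycle Zp) (cycle Zq) = cycle λ i →
  trans (sumCols-⊕ A p q i) (cong₂ _xor_ (Zp i) (Zq i))

parity : Subset m → Subset m → Bool
parity []      []      = false
parity (g ∷ G) (z ∷ Z) = (z ∧ g) xor parity G Z

sumCols-row : ∀ (A : BMatrix r m) i (G : Subset m) → (∀ j → A j i ≡ G ! j) →
              ∀ Z → sumCols A Z i ≡ parity G Z
sumCols-row {m = zero}  A i []      same []      = refl
sumCols-row {m = suc m} A i (g ∷ G) same (z ∷ Z) =
  cong₂ (λ a s → (z ∧ a) xor s) (same zero) (sumCols-row (λ j → A (suc j)) i G (λ j → same (suc j)) Z)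

parity-⊕ʳ : ∀ (G p q : Subset m) → parity G (p ⊕ q) ≡ (parity G p xor parity G q)
parity-⊕ʳ []      []      []      = refl
parity-⊕ʳ (g ∷ G) (a ∷ p) (b ∷ q) rewrite parity-⊕ʳ G p q = ∧-xor-regroup a b g _ _

parity-⊥ʳ : ∀ (G : Subset m) → parity G ⊥ ≡ false
parity-⊥ʳ []      = refl
parity-⊥ʳ (g ∷ G) = parity-⊥ʳ G

parity-sym : ∀ (G Z : Subset m) → parity G Z ≡ parity Z G
parity-sym []      []      = refl
parity-sym (g ∷ G) (z ∷ Z) = cong₂ _xor_ (BoolP.∧-comm z g) (parity-sym G Z)

parity-⊥ˡ : ∀ (Z : Subset m) → parity ⊥ Z ≡ false
parity-⊥ˡ Z = trans (parity-sym ⊥ Z) (parity-⊥ʳ Z)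

parity-⊕ˡ : ∀ (p q Z : Subset m) → parity (p ⊕ q) Z ≡ (parity p Z xor parity q Z)
parity-⊕ˡ p q Z rewrite parity-sym (p ⊕ q) Z | parity-sym p Z | parity-sym q Z = parity-⊕ʳ Z p q

parity-cong : ∀ (G H Z : Subset m) → (∀ u → Z ! u ≡ true → G ! u ≡ H ! u) → parity G Z ≡ parity H Z
parity-cong []      []      []      agree = refl
parity-cong (g ∷ G) (h ∷ H) (z ∷ Z) agree =
  cong₂ _xor_ (head z (agree zero)) (parity-cong G H Z (λ u → agree (suc u)))
  where
  head : ∀ z → (z ≡ true → g ≡ h) → z ∧ g ≡ z ∧ h
  head true  same = same refl
  head false same = refl

parity-⁅⁆ : ∀ (x : Fin m) (Z : Subset m) → parity ⁅ x ⁆ Z ≡ Z ! x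
parity-⁅⁆ zero    (z ∷ Z) rewrite parity-⊥ˡ Z | BoolP.∧-identityʳ z = BoolP.xor-identityʳ z
parity-⁅⁆ (suc x) (z ∷ Z) rewrite BoolP.∧-zeroʳ z = parity-⁅⁆ x Z

parity-single : ∀ (G Z : Subset m) x → parity (G ∩ ⁅ x ⁆) Z ≡ (G ! x ∧ Z ! x)
parity-single (g ∷ G) (z ∷ Z) zero
  rewrite ∩-zeroʳ G | parity-⊥ˡ Z | BoolP.∧-identityʳ g | BoolP.xor-identityʳ (z ∧ g) = BoolP.∧-comm z g
parity-single (g ∷ G) (z ∷ Z) (suc x) rewrite BoolP.∧-zeroʳ g | BoolP.∧-zeroʳ z = parity-single G Z x

parity-near : ∀ {S x} (G H Z : Subset m) → Z ⊆ S ∪ ⁅ x ⁆ → Z ! x ≡ true →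
              (∀ u → S ! u ≡ true → G ! u ≡ H ! u) → H ! x ≡ false →
              parity G Z ≡ (parity H Z xor G ! x)
parity-near {S = S} {x} G H Z Z⊆ Zx agree Hx =
  begin
    parity G Z                               ≡⟨ parity-cong G (H ⊕ (G ∩ ⁅ x ⁆)) Z agree-on-Z ⟩
    parity (H ⊕ (G ∩ ⁅ x ⁆)) Z               ≡⟨ parity-⊕ˡ H (G ∩ ⁅ x ⁆) Z ⟩
    parity H Z xor parity (G ∩ ⁅ x ⁆) Z      ≡⟨ cong (parity H Z xor_) (parity-single G Z x) ⟩
    parity H Z xor (G ! x ∧ Z ! x)           ≡⟨ cong (λ b → parity H Z xor (G ! x ∧ b)) Zx ⟩
    parity H Z xor (G ! x ∧ true)            ≡⟨ cong (parity H Z xor_) (BoolP.∧-identityʳ (G ! x)) ⟩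
    parity H Z xor G ! x                     ∎
  where
  open ≡-Reasoning
  agree-on-Z : ∀ u → Z ! u ≡ true → G ! u ≡ (H ⊕ (G ∩ ⁅ x ⁆)) ! u
  agree-on-Z u Zu rewrite !⊕ H (G ∩ ⁅ x ⁆) u | !∩ G ⁅ x ⁆ u with ∪⁅⁆⁻ S x u (⊆E Z⊆ u Zu)
  ... | inj₂ refl rewrite Hx | !⁅⁆-same u = sym (BoolP.∧-identityʳ (G ! u))
  ... | inj₁ Su with u FinP.≟ x
  ...   | yes refl rewrite Hx | !⁅⁆-same u = sym (BoolP.∧-identityʳ (G ! u))
  ...   | no  u≢x rewrite !⁅⁆-diff u≢x | BoolP.∧-zeroʳ (G ! u) =
    trans (agree u Su) (sym (BoolP.xor-identityʳ (H ! u)))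

isOdd : ℕ → Bool
isOdd zero    = false
isOdd (suc k) = not (isOdd k)

Odd⇔isOdd : ∀ k → Odd k ⇔ isOdd k ≡ true
Odd⇔isOdd k = mk⇔ (to k) (from k)
  where
  to : ∀ k → Odd k → isOdd k ≡ true
  to (suc zero)    _ = refl
  to (suc (suc k)) o rewrite BoolP.not-involutive (isOdd k) = to k o
  from : ∀ k → isOdd k ≡ true → Odd k
  from (suc zero)    _ = refl
  from (suc (suc k)) e rewrite BoolP.not-involutive (isOdd k) = from k e

parity-card : ∀ (G Z : Subset m) → parity G Z ≡ isOdd ∣ Z ∩ G ∣
parity-card []      []      = refl
parity-card (g ∷ G) (z ∷ Z) rewrite parity-card G Z with z ∧ g
... | true  = refl
... | false = refl

Odd⇔parity : ∀ (T C : Subset m) → Odd ∣ C ∩ T ∣ ⇔ parity T C ≡ true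
Odd⇔parity T C = mk⇔
  (λ odd → trans (parity-card T C) (Equivalence.to (Odd⇔isOdd ∣ C ∩ T ∣) odd))
  (λ odd → Equivalence.from (Odd⇔isOdd ∣ C ∩ T ∣) (trans (sym (parity-card T C)) odd))

-- Independence, ranks and bases.  X is dependent iff it contains a nonempty
-- cycle, which makes independence, bases and coindependence decidable.

CycleIn : BMatrix r m → Subset m → Subset m → Set
CycleIn A X Y = Y ⊆ X × Cycle A Y × Nonempty Y

independent? : ∀ (A : BMatrix r m) X → Dec (Independent A X)
independent? A X with anySubset? (λ Y → Y ⊆? X ×-dec cycle? A Y ×-dec nonempty? Y)
... | yes (Y , Y⊆X , ZY , neY) = no (λ ind → ind Y Y⊆X (sums-to-zero ZY) neY)
... | no  none                 = yes (λ Y Y⊆X ZY neY → none (Y , Y⊆X , cycle ZY , neY))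

dependent⇒cycle : ∀ (A : BMatrix r m) X → Dependent A X → ∃ (CycleIn A X)
dependent⇒cycle A X dep with anySubset? (λ Y → Y ⊆? X ×-dec cycle? A Y ×-dec nonempty? Y)
... | yes found = found
... | no  none  = ⊥-elim (dep (λ Y Y⊆X ZY neY → none (Y , Y⊆X , cycle ZY , neY)))

independent-cycle : ∀ {X Y} → Independent A X → Y ⊆ X → Cycle A Y → Y ≡ ⊥
independent-cycle ind Y⊆X ZY = Empty-unique (ind _ Y⊆X (sums-to-zero ZY))

independent-⊥ : Independent A ⊥
independent-⊥ Y Y⊆⊥ _ (_ , y∈Y) = ∉⊥ (Y⊆⊥ y∈Y)

rank-exists : ∀ (A : BMatrix r m) X → ∃ (HasRank A X)
rank-exists A X with largest (λ I → I ⊆? X ×-dec independent? A I) (⊥ , ⊥⊆ , independent-⊥)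
... | I , (I⊆X , indI) , max = ∣ I ∣ , (I , I⊆X , indI , refl) , λ J J⊆X indJ → max J (J⊆X , indJ)

extend-to-basis : ∀ {I} → Independent A I → ∃ λ B → I ⊆ B × Basis A B
extend-to-basis {A = A} {I} indI
  with largest (λ J → I ⊆? J ×-dec independent? A J) (I , ⊆-refl , indI)
... | B , (I⊆B , indB) , max = B , I⊆B , indB , maximal
  where
  maximal : ∀ J → B ⊆ J → Independent A J → J ≡ B
  maximal J B⊆J indJ = sym (⊆-¬⊂⇒≡ B⊆J (λ B⊂J →
    <-irrefl refl (<-≤-trans (p⊂q⇒∣p∣<∣q∣ B⊂J) (max J (⊆-trans I⊆B B⊆J , indJ)))))

all-subsets? : ∀ {P : Subset m → Set} → (∀ p → Dec (P p)) → Dec (∀ p → P p)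
all-subsets? P? with anySubset? (λ p → ¬? (P? p))
... | yes (p , ¬Pp) = no (λ all → ¬Pp (all p))
... | no  none      = yes (λ p → decidable-stable (P? p) (λ ¬Pp → none (p , ¬Pp)))

basis? : ∀ (A : BMatrix r m) B → Dec (Basis A B)
basis? A B = independent? A B ×-dec
  all-subsets? (λ J → B ⊆? J →-dec (independent? A J →-dec ≡-dec BoolP._≟_ J B))

coindependent? : ∀ (A : BMatrix r m) X → Dec (CoIndependent A X)
coindependent? A X = anySubset? (λ B → basis? A B ×-dec X ⊆? ∁ B)

-- By descent on ∣ W − I ∣: adding the
-- cycle through c ∈ W − I removes c and adds nothing outside I.
even-by-span : ∀ {I Y} (G : Subset m) → Independent A I → I ⊆ Y →
  (∀ c → Y ! c ≡ true → I ! c ≡ false →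
     ∃ λ Z → Z ⊆ I ∪ ⁅ c ⁆ × Cycle A Z × Z ! c ≡ true × parity G Z ≡ false) →
  ∀ W → W ⊆ Y → Cycle A W → parity G W ≡ false
even-by-span {A = A} {I} {Y} G indI I⊆Y through W = descend (suc ∣ W ∩ ∁ I ∣) W ≤-refl
  where
  descend : ∀ fuel W → ∣ W ∩ ∁ I ∣ < fuel → W ⊆ Y → Cycle A W → parity G W ≡ false
  descend (suc fuel) W lt W⊆Y ZW with nonempty? (W ∩ ∁ I)
  ... | no none = subst (λ V → parity G V ≡ false)
                        (sym (independent-cycle indI (outside-empty none) ZW)) (parity-⊥ʳ G)
  ... | yes (c , c∈) with ∩⁻ W (∁ I) c (∈⇒! c∈)
  ...   | Wc , I′c with through c (⊆E W⊆Y c Wc) (∁⁻ I c I′c)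
  ...     | Z , Z⊆ , ZZ , Zc , even =
    begin
      parity G W                    ≡⟨ sym (BoolP.xor-identityʳ _) ⟩
      parity G W xor false          ≡⟨ cong (parity G W xor_) (sym even) ⟩
      parity G W xor parity G Z     ≡⟨ sym (parity-⊕ʳ G W Z) ⟩
      parity G (W ⊕ Z)              ≡⟨ descend fuel (W ⊕ Z) smaller (⊕-⊆ W⊆Y Z⊆Y) (cycle-⊕ ZW ZZ) ⟩
      false                         ∎
    where
    open ≡-Reasoning
    Z⊆Y : Z ⊆ Y
    Z⊆Y = ⊆-trans Z⊆ (∪⁅⁆-⊆ I⊆Y (⊆E W⊆Y c Wc))
    smaller : ∣ (W ⊕ Z) ∩ ∁ I ∣ < fuel
    smaller = <-≤-trans (p⊂q⇒∣p∣<∣q∣ (⊕-shrinks-outside W Z Wc (∁⁻ I c I′c) Z⊆ Zc)) (≤-pred lt)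

-- An independent set I is a basis as soon as every x ∉ I lies on a cycle
-- inside I + x: no independent superset can then contain x.
spanning⇒basis : ∀ {I} → Independent A I →
  (∀ x → I ! x ≡ false → ∃ λ Z → Z ⊆ I ∪ ⁅ x ⁆ × Cycle A Z × Z ! x ≡ true) → Basis A I
spanning⇒basis {A = A} {I} indI span = indI , λ J I⊆J indJ → ⊆-antisym (⊆I (in-I J I⊆J indJ)) I⊆J
  where
  in-I : ∀ J → I ⊆ J → Independent A J → ∀ x → J ! x ≡ true → I ! x ≡ true
  in-I J I⊆J indJ x Jx with I ! x in Ix
  ... | true  = refl
  ... | false with span x Ix
  ...   | Z , Z⊆ , ZZ , Zx =
    ⊥-elim (indJ Z (⊆-trans Z⊆ (∪⁅⁆-⊆ I⊆J Jx)) (sums-to-zero ZZ) (nonempty-! Zx))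

-- A cocycle of M[A] is a set meeting every cycle evenly; the cocycles form
-- the row space of A.
record Cocycle (A : BMatrix r m) (G : Subset m) : Set where
  constructor cocycle
  field meets-evenly : ∀ Z → Cycle A Z → parity G Z ≡ false

open Cocycle

cocycle-⊕ : ∀ {G H} → Cocycle A G → Cocycle A H → Cocycle A (G ⊕ H)
cocycle-⊕ {G = G} {H} (cocycle coG) (cocycle coH) = cocycle λ Z ZZ →
  trans (parity-⊕ˡ G H Z) (cong₂ _xor_ (coG Z ZZ) (coH Z ZZ))

swap : Subset m → Fin m → Fin m → Subset m
swap B e x = (B ∖ e) ∪ ⁅ x ⁆

module Swap (B : Subset m) (e x : Fin m) where

  B∖e⊆swap : ∀ v → B ! v ≡ true → v ≢ e → swap B e x ! v ≡ true
  B∖e⊆swap v Bv v≢e = ∪⁺ˡ (B ∖ e) ⁅ x ⁆ v (∖⁺ B e v Bv v≢e)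

  e∉swap : B ! e ≡ true → B ! x ≡ false → swap B e x ! e ≡ false
  e∉swap Be Bx with swap B e x ! e in B′e
  ... | false = refl
  ... | true with ∪⁅⁆⁻ (B ∖ e) x e B′e
  ...   | inj₁ B∖e∋e = clash B∖e∋e (∖-same B e)
  ...   | inj₂ refl  = clash Be Bx

  swap⊆B+x : swap B e x ⊆ B ∪ ⁅ x ⁆
  swap⊆B+x = ⊆I λ v B′v → case-∪⁅⁆ v (∪⁅⁆⁻ (B ∖ e) x v B′v)
    where
    case-∪⁅⁆ : ∀ v → (B ∖ e) ! v ≡ true ⊎ v ≡ x → (B ∪ ⁅ x ⁆) ! v ≡ true
    case-∪⁅⁆ v (inj₁ B∖e∋v) = ∪⁺ˡ B ⁅ x ⁆ v (proj₁ (∖⁻ B e v B∖e∋v))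
    case-∪⁅⁆ v (inj₂ refl)  = ∈-∪⁅⁆ B v

  B+x⊆swap+e : B ∪ ⁅ x ⁆ ⊆ swap B e x ∪ ⁅ e ⁆
  B+x⊆swap+e = ⊆I λ v B+x∋v → case-∪⁅⁆ v (∪⁅⁆⁻ B x v B+x∋v)
    where
    case-∪⁅⁆ : ∀ v → B ! v ≡ true ⊎ v ≡ x → (swap B e x ∪ ⁅ e ⁆) ! v ≡ true
    case-∪⁅⁆ v (inj₂ refl) = ∪⁺ˡ (swap B e v) ⁅ e ⁆ v (∈-∪⁅⁆ (B ∖ e) v)
    case-∪⁅⁆ v (inj₁ Bv) with v FinP.≟ e
    ... | yes refl = ∈-∪⁅⁆ (swap B e x) v
    ... | no  v≢e  = ∪⁺ˡ (swap B e x) ⁅ e ⁆ v (B∖e⊆swap v Bv v≢e)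

  into-swap : ∀ {Z u} → Z ⊆ (B ∪ ⁅ x ⁆) ∪ ⁅ u ⁆ → Z ! e ≡ false → Z ⊆ swap B e x ∪ ⁅ u ⁆
  into-swap {Z} {u} Z⊆ Ze = ⊆I λ v Zv → case-∪⁅⁆ v Zv (∪⁅⁆⁻ (B ∪ ⁅ x ⁆) u v (⊆E Z⊆ v Zv))
    where
    case-∪⁅⁆ : ∀ v → Z ! v ≡ true → (B ∪ ⁅ x ⁆) ! v ≡ true ⊎ v ≡ u → (swap B e x ∪ ⁅ u ⁆) ! v ≡ true
    case-∪⁅⁆ v Zv (inj₂ refl) = ∈-∪⁅⁆ (swap B e x) v
    case-∪⁅⁆ v Zv (inj₁ B+x∋v) with ∪⁅⁆⁻ B x v B+x∋v
    ... | inj₂ refl = ∪⁺ˡ (swap B e v) ⁅ u ⁆ v (∈-∪⁅⁆ (B ∖ e) v)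
    ... | inj₁ Bv   = ∪⁺ˡ (swap B e x) ⁅ u ⁆ v (B∖e⊆swap v Bv λ { refl → clash Zv Ze })

module Fundamental {A : BMatrix r m} {B : Subset m} (basis : Basis A B) where

  -- As B is a maximal independent set, B + x contains a cycle for x ∉ B, and
  -- that cycle passes through x since B itself is independent.
  fundamental-cycle : ∀ {x} → B ! x ≡ false → ∃ λ Z → Z ⊆ B ∪ ⁅ x ⁆ × Cycle A Z × Z ! x ≡ true
  fundamental-cycle {x} Bx with independent? A (B ∪ ⁅ x ⁆)
  ... | yes ind = clash (subst (λ S → S ! x ≡ true) (proj₂ basis _ (⊆-∪⁅⁆ B x) ind) (∈-∪⁅⁆ B x)) Bx
  ... | no dep with dependent⇒cycle A _ dep
  ...   | Z , Z⊆ , ZZ , neZ with Z ! x in Zx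
  ...     | true  = Z , Z⊆ , ZZ , Zx
  ...     | false = ⊥-elim (¬nonempty-⊥ (subst Nonempty
                      (independent-cycle (proj₁ basis) (⊆-∪⁅⁆-avoid Z⊆ Zx) ZZ) neZ))

  -- Two cycles inside B + x through x coincide: their sum is a cycle inside B.
  fundamental-unique : ∀ {x Z₁ Z₂} → Z₁ ⊆ B ∪ ⁅ x ⁆ → Z₂ ⊆ B ∪ ⁅ x ⁆ → Cycle A Z₁ → Cycle A Z₂ →
                       Z₁ ! x ≡ true → Z₂ ! x ≡ true → Z₁ ≡ Z₂
  fundamental-unique {x} {Z₁} {Z₂} Z₁⊆ Z₂⊆ ZZ₁ ZZ₂ Z₁x Z₂x = ⊕≡⊥⇒≡
    (independent-cycle (proj₁ basis)
      (⊆-∪⁅⁆-avoid (⊕-⊆ Z₁⊆ Z₂⊆) (⊕-same Z₁ Z₂ x (trans Z₁x (sym Z₂x)))) (cycle-⊕ ZZ₁ ZZ₂))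

  -- In both cases it is the set of elements of B + x needed to
  -- express x in terms of B, together with x.
  fundSet : Fin m → Subset m
  fundSet x with x ∈? B
  ... | yes _   = ⁅ x ⁆
  ... | no  x∉B = proj₁ (fundamental-cycle (∉⇒! x∉B))

  fundSet-⊆ : ∀ x → fundSet x ⊆ B ∪ ⁅ x ⁆
  fundSet-⊆ x with x ∈? B
  ... | yes _   = ⊆I (λ u → ∪⁺ʳ B ⁅ x ⁆ u)
  ... | no  x∉B = proj₁ (proj₂ (fundamental-cycle (∉⇒! x∉B)))

  fundSet-∋ : ∀ x → fundSet x ! x ≡ true
  fundSet-∋ x with x ∈? B
  ... | yes _   = !⁅⁆-same x
  ... | no  x∉B = proj₂ (proj₂ (proj₂ (fundamental-cycle (∉⇒! x∉B))))

  fundSet-basic : ∀ x → B ! x ≡ true → fundSet x ≡ ⁅ x ⁆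
  fundSet-basic x Bx with x ∈? B
  ... | yes _   = refl
  ... | no  x∉B = clash Bx (∉⇒! x∉B)

  fundSet-cycle : ∀ x → B ! x ≡ false → Cycle A (fundSet x)
  fundSet-cycle x Bx with x ∈? B
  ... | yes x∈B = clash (∈⇒! x∈B) Bx
  ... | no  x∉B = proj₁ (proj₂ (proj₂ (fundamental-cycle (∉⇒! x∉B))))

  fundSet-unique : ∀ {x Z} → B ! x ≡ false → Z ⊆ B ∪ ⁅ x ⁆ → Cycle A Z → Z ! x ≡ true → Z ≡ fundSet x
  fundSet-unique {x} Bx Z⊆ ZZ Zx =
    fundamental-unique Z⊆ (fundSet-⊆ x) ZZ (fundSet-cycle x Bx) Zx (fundSet-∋ x)

  even-by-fundamental : ∀ (G : Subset m) → (∀ x → B ! x ≡ false → parity G (fundSet x) ≡ false) →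
                        Cocycle A G
  even-by-fundamental G even = cocycle λ Z ZZ → even-by-span G (proj₁ basis) ⊆⊤
    (λ x _ Bx → fundSet x , fundSet-⊆ x , fundSet-cycle x Bx , fundSet-∋ x , even x Bx) Z ⊆⊤ ZZ

  exchange : ∀ {e x} → B ! e ≡ true → B ! x ≡ false → fundSet x ! e ≡ true → Basis A (swap B e x)
  exchange {e} {x} Be Bx Fxe = spanning⇒basis independent spanning
    where
    open Swap B e x
    F⊆B+x+ : ∀ u → fundSet u ⊆ (B ∪ ⁅ x ⁆) ∪ ⁅ u ⁆
    F⊆B+x+ u = ⊆-trans (fundSet-⊆ u) (∪⁅⁆-⊆ (⊆-trans (⊆-∪⁅⁆ B x) (⊆-∪⁅⁆ _ u)) (∈-∪⁅⁆ (B ∪ ⁅ x ⁆) u))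
    -- A cycle inside B − e + x avoiding x lies in B; through x it would be the
    -- fundamental cycle of x, which contains e.
    independent : Independent A (swap B e x)
    independent W W⊆ WZ neW with W ! x in Wx
    ... | false = ¬nonempty-⊥ (subst Nonempty
                    (independent-cycle (proj₁ basis) (⊆-∪⁅⁆-avoid (⊆-trans W⊆ swap⊆B+x) Wx) (cycle WZ)) neW)
    ... | true  = clash (⊆E W⊆ e (subst (λ S → S ! e ≡ true) (sym W≡Fx) Fxe)) (e∉swap Be Bx)
      where
      W≡Fx : W ≡ fundSet x
      W≡Fx = fundSet-unique Bx (⊆-trans W⊆ swap⊆B+x) (cycle WZ) Wx
    -- e is spanned by the fundamental cycle of x; any other u ∉ B − e + x by
    -- its own fundamental cycle, corrected by that of x when it passes through e.
    spanning : ∀ u → swap B e x ! u ≡ false → ∃ λ Z → Z ⊆ swap B e x ∪ ⁅ u ⁆ × Cycle A Z × Z ! u ≡ true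
    spanning u B′u with u FinP.≟ e
    ... | yes refl = fundSet x , ⊆-trans (fundSet-⊆ x) B+x⊆swap+e , fundSet-cycle x Bx , Fxe
    ... | no u≢e with B ! u in Bu | fundSet u ! e in Fue
    ...   | true  | _     = clash (B∖e⊆swap u Bu u≢e) B′u
    ...   | false | false = fundSet u , into-swap (F⊆B+x+ u) Fue , fundSet-cycle u Bu , fundSet-∋ u
    ...   | false | true  =
      fundSet u ⊕ fundSet x ,
      into-swap (⊕-⊆ (F⊆B+x+ u) (⊆-trans (fundSet-⊆ x) (⊆-∪⁅⁆ _ u)))
                (⊕-same (fundSet u) (fundSet x) e (trans Fue (sym Fxe))) ,
      cycle-⊕ (fundSet-cycle u Bu) (fundSet-cycle x Bx) ,
      ⊕⁺ˡ (fundSet u) (fundSet x) u (fundSet-∋ u) Fxu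
      where
      Fxu : fundSet x ! u ≡ false
      Fxu with fundSet x ! u in Fx∋u
      ... | false = refl
      ... | true with ∪⁅⁆⁻ B x u (⊆E (fundSet-⊆ x) u Fx∋u)
      ...   | inj₁ B∋u  = clash B∋u Bu
      ...   | inj₂ refl = clash (∈-∪⁅⁆ (B ∖ e) u) B′u

  fundSet-within : ∀ {I x} → I ⊆ B → Dependent A (I ∪ ⁅ x ⁆) → B ! x ≡ false → fundSet x ⊆ I ∪ ⁅ x ⁆
  fundSet-within {I} {x} I⊆B dep Bx with dependent⇒cycle A _ dep
  ... | W , W⊆ , ZW , neW with W ! x in Wx
  ...   | true  = subst (_⊆ I ∪ ⁅ x ⁆) (fundSet-unique Bx (⊆-trans W⊆ I+x⊆B+x) ZW Wx) W⊆
    where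
    I+x⊆B+x : I ∪ ⁅ x ⁆ ⊆ B ∪ ⁅ x ⁆
    I+x⊆B+x = ∪⁅⁆-⊆ (⊆-trans I⊆B (⊆-∪⁅⁆ B x)) (∈-∪⁅⁆ B x)
  ...   | false = ⊥-elim (¬nonempty-⊥ (subst Nonempty
                    (independent-cycle (proj₁ basis) (⊆-trans (⊆-∪⁅⁆-avoid W⊆ Wx) I⊆B) ZW) neW))

  -- The fundamental cocircuit of e ∈ B consists of the x whose fundamental set
  -- contains e; it is a cocycle, since it meets each fundamental cycle in e and x.
  fundCocircuit : Fin m → Subset m
  fundCocircuit e = tabulate (λ x → fundSet x ! e)

  !fundCocircuit : ∀ e x → fundCocircuit e ! x ≡ fundSet x ! e
  !fundCocircuit e x = lookup∘tabulate (λ x → fundSet x ! e) x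

  fundCocircuit-∋ : ∀ e → fundCocircuit e ! e ≡ true
  fundCocircuit-∋ e = trans (!fundCocircuit e e) (fundSet-∋ e)

  fundCocircuit-cocycle : ∀ {e} → B ! e ≡ true → Cocycle A (fundCocircuit e)
  fundCocircuit-cocycle {e} Be = even-by-fundamental (fundCocircuit e) λ x Bx →
    begin
      parity F (fundSet x)                   ≡⟨ parity-near F ⁅ e ⁆ (fundSet x) (fundSet-⊆ x) (fundSet-∋ x)
                                                   on-B (!⁅⁆-diff {x = x} {y = e} (λ { refl → clash Be Bx })) ⟩
      parity ⁅ e ⁆ (fundSet x) xor F ! x     ≡⟨ cong₂ _xor_ (parity-⁅⁆ e (fundSet x)) (!fundCocircuit e x) ⟩
      fundSet x ! e xor fundSet x ! e        ≡⟨ BoolP.xor-same (fundSet x ! e) ⟩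
      false                                  ∎
    where
    open ≡-Reasoning
    F : Subset m
    F = fundCocircuit e
    on-B : ∀ u → B ! u ≡ true → F ! u ≡ ⁅ e ⁆ ! u
    on-B u Bu rewrite !fundCocircuit e u | fundSet-basic u Bu with u FinP.≟ e
    ... | yes refl = refl
    ... | no  u≢e  = trans (!⁅⁆-diff (λ e≡u → u≢e (sym e≡u))) (sym (!⁅⁆-diff u≢e))

  -- A codependent Q meeting B exactly in e contains the fundamental cocircuit
  -- of e: otherwise swapping e for some x ∈ fundCocircuit e − Q would give a
  -- basis avoiding Q.
  fundCocircuit-⊆ : ∀ {e Q} → B ! e ≡ true → Q ! e ≡ true → (∀ u → Q ! u ≡ true → B ! u ≡ true → u ≡ e) →
                    CoDependent A Q → fundCocircuit e ⊆ Q
  fundCocircuit-⊆ {e} {Q} Be Qe Q∩B codep = ⊆I in-Q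
    where
    in-Q : ∀ x → fundCocircuit e ! x ≡ true → Q ! x ≡ true
    in-Q x Fx with Q ! x in Qx | B ! x in Bx
    ... | true  | _    = refl
    ... | false | true = clash (subst (λ u → Q ! u ≡ true) e≡x Qe) Qx
      where
      e≡x : e ≡ x
      e≡x = !⁅⁆⁻ (subst (λ S → S ! e ≡ true) (fundSet-basic x Bx) (trans (sym (!fundCocircuit e x)) Fx))
    ... | false | false = ⊥-elim (codep (swap B e x , exchange Be Bx (trans (sym (!fundCocircuit e x)) Fx) ,
                                          ⊆I λ v Qv → ∁⁺ (swap B e x) v (avoids v Qv)))
      where
      avoids : ∀ v → Q ! v ≡ true → swap B e x ! v ≡ false
      avoids v Qv with swap B e x ! v in B′v
      ... | false = refl
      ... | true with ∪⁅⁆⁻ (B ∖ e) x v B′v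
      ...   | inj₂ refl = clash Qv Qx
      ...   | inj₁ B∖e∋v with ∖⁻ B e v B∖e∋v
      ...     | Bv , v≢e = ⊥-elim (v≢e (Q∩B v Qv Bv))

-- Circuits and cocircuits.

-- Circuits are cycles: a circuit contains a nonempty cycle, which by
-- minimality is the whole circuit.
circuit-cycle : ∀ {C} → Circuit A C → Cycle A C
circuit-cycle {A = A} {C} (dep , min) with dependent⇒cycle A C dep
... | W , W⊆C , ZW , neW = subst (Cycle A) (min W W⊆C (λ ind → ind W ⊆-refl (sums-to-zero ZW) neW)) ZW

odd⇒nonempty : ∀ (T Z : Subset m) → parity T Z ≡ true → Nonempty Z
odd⇒nonempty T Z odd with nonempty? Z
... | yes neZ = neZ
... | no  Z∅  = clash odd (subst (λ V → parity T V ≡ false) (sym (Empty-unique Z∅)) (parity-⊥ʳ T))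

-- Every cycle meeting T oddly contains a circuit meeting T oddly: a minimal
-- such cycle C is a circuit, because a nonempty cycle W ⊊ C would leave the
-- smaller odd cycle W or C ⊕ W.
odd-circuit : ∀ (T Z : Subset m) → Cycle A Z → parity T Z ≡ true →
              ∃ λ C → C ⊆ Z × Circuit A C × parity T C ≡ true
odd-circuit {A = A} T Z ZZ odd
  with minimal (λ W → cycle? A W ×-dec (parity T W BoolP.≟ true)) Z (ZZ , odd)
... | C , C⊆Z , (ZC , oddC) , min = C , C⊆Z , (dependent , circuit-min) , oddC
  where
  only-cycle : ∀ W → W ⊆ C → Cycle A W → Nonempty W → W ≡ C
  only-cycle W W⊆C ZW (y , y∈W) with parity T W in pW
  ... | true  = min W W⊆C (ZW , pW)
  ... | false = clash (subst (λ S → S ! y ≡ true) (sym C⊕W≡C) Cy)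
                      (⊕-same C W y (trans Cy (sym (∈⇒! y∈W))))
    where
    Cy : C ! y ≡ true
    Cy = ∈⇒! (W⊆C y∈W)
    C⊕W≡C : C ⊕ W ≡ C
    C⊕W≡C = min (C ⊕ W) (⊕-⊆ ⊆-refl W⊆C)
              (cycle-⊕ ZC ZW , trans (parity-⊕ʳ T C W) (cong₂ _xor_ oddC pW))
  dependent : Dependent A C
  dependent ind = ind C ⊆-refl (sums-to-zero ZC) (odd⇒nonempty T C oddC)
  circuit-min : ∀ D → D ⊆ C → Dependent A D → D ≡ C
  circuit-min D D⊆C depD with dependent⇒cycle A D depD
  ... | W , W⊆D , ZW , neW = ⊆-antisym D⊆C (subst (_⊆ D) (only-cycle W (⊆-trans W⊆D D⊆C) ZW neW) W⊆D)

EvenCycles : BMatrix r m → Subset m → Subset m → Set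
EvenCycles A T Y = ∀ Z → Z ⊆ Y → Cycle A Z → parity T Z ≡ false

odd-circuit-or-even : ∀ (A : BMatrix r m) T Y →
  (∃ λ C → Circuit A C × Odd ∣ C ∩ T ∣ × C ⊆ Y) ⊎ EvenCycles A T Y
odd-circuit-or-even A T Y with anySubset? (λ Z → Z ⊆? Y ×-dec cycle? A Z ×-dec (parity T Z BoolP.≟ true))
... | yes (Z , Z⊆Y , ZZ , oddZ) with odd-circuit T Z ZZ oddZ
...   | C , C⊆Z , circuit , oddC =
  inj₁ (C , circuit , Equivalence.from (Odd⇔parity T C) oddC , ⊆-trans C⊆Z Z⊆Y)
odd-circuit-or-even A T Y | no none = inj₂ λ Z Z⊆Y ZZ → BoolP.¬-not (λ oddZ → none (Z , Z⊆Y , ZZ , oddZ))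

basis-exists : ∀ (A : BMatrix r m) → ∃ (Basis A)
basis-exists A with extend-to-basis {A = A} independent-⊥
... | B , _ , basis = B , basis

-- A nonempty cocycle G is codependent: if G avoided a basis B, the
-- fundamental cycle of any y ∈ G would meet G exactly in y.
cocycle-codependent : ∀ {G} → Cocycle A G → Nonempty G → CoDependent A G
cocycle-codependent {A = A} {G} coG (y , y∈G) (B , basis , G⊆∁B) =
  clash meets-once (meets-evenly coG (fundSet y) (fundSet-cycle y By))
  where
  open Fundamental basis
  open ≡-Reasoning
  Gy : G ! y ≡ true
  Gy = ∈⇒! y∈G
  By : B ! y ≡ false
  By = ∁⁻ B y (⊆E G⊆∁B y Gy)
  off-B : ∀ u → B ! u ≡ true → G ! u ≡ ⊥ ! u
  off-B u Bu with G ! u in Gu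
  ... | true  = clash Bu (∁⁻ B u (⊆E G⊆∁B u Gu))
  ... | false = sym (!⊥ u)
  meets-once : parity G (fundSet y) ≡ true
  meets-once = begin
    parity G (fundSet y)               ≡⟨ parity-near G ⊥ (fundSet y) (fundSet-⊆ y) (fundSet-∋ y) off-B (!⊥ y) ⟩
    parity ⊥ (fundSet y) xor G ! y     ≡⟨ cong₂ _xor_ (parity-⊥ˡ (fundSet y)) Gy ⟩
    true                               ∎

-- The empty set avoids every basis, so cocircuits are nonempty.
cocircuit-nonempty : ∀ {Q} → Cocircuit A Q → Nonempty Q
cocircuit-nonempty {A = A} {Q} (codep , _) with nonempty? Q
... | yes neQ = neQ
... | no  Q∅ with basis-exists A
...   | B , basis = ⊥-elim (codep (B , basis , subst (_⊆ ∁ B) (sym (Empty-unique Q∅)) ⊥⊆))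

cocircuit-minus : ∀ {Q e} → Cocircuit A Q → Q ! e ≡ true → CoIndependent A (Q ∖ e)
cocircuit-minus {A = A} {Q} {e} (codep , min) Qe = decidable-stable (coindependent? A (Q ∖ e)) λ codep′ →
  clash Qe (subst (λ S → S ! e ≡ false) (min (Q ∖ e) (⊆I λ u Q∖e∋u → proj₁ (∖⁻ Q e u Q∖e∋u)) codep′)
                  (∖-same Q e))

-- For e ∈ Q the set Q − e avoids a basis B,
-- which must contain e; then Q contains the fundamental cocircuit of e, a
-- nonempty cocycle, and equals it by minimality.
cocircuit-cocycle : ∀ {Q} → Cocircuit A Q → Cocycle A Q
cocircuit-cocycle {A = A} {Q} cc@(codep , min) with cocircuit-nonempty cc
... | e , e∈Q with cocircuit-minus cc (∈⇒! e∈Q)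
...   | B , basis , Q∖e⊆∁B = subst (Cocycle A) F≡Q (fundCocircuit-cocycle Be)
  where
  open Fundamental basis
  Qe : Q ! e ≡ true
  Qe = ∈⇒! e∈Q
  Q∩B : ∀ u → Q ! u ≡ true → B ! u ≡ true → u ≡ e
  Q∩B u Qu Bu with u FinP.≟ e
  ... | yes u≡e = u≡e
  ... | no  u≢e = clash Bu (∁⁻ B u (⊆E Q∖e⊆∁B u (∖⁺ Q e u Qu u≢e)))
  Be : B ! e ≡ true
  Be with B ! e in B∌e
  ... | true  = refl
  ... | false = ⊥-elim (codep (B , basis , ⊆I λ u Qu → ∁⁺ B u (off-B u Qu)))
    where
    off-B : ∀ u → Q ! u ≡ true → B ! u ≡ false
    off-B u Qu with B ! u in Bu
    ... | false = refl
    ... | true with Q∩B u Qu Bu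
    ...   | refl = clash Bu B∌e
  F≡Q : fundCocircuit e ≡ Q
  F≡Q = min (fundCocircuit e) (fundCocircuit-⊆ Be Qe Q∩B codep)
            (cocycle-codependent (fundCocircuit-cocycle Be) (nonempty-! (fundCocircuit-∋ e)))

-- Take a cocircuit
-- Q ⊆ G (a minimal codependent subset); if Q is not T-majority, the smaller
-- cocycle G − Q = G ⊕ Q still is, and we descend.
majority-cocircuit : ∀ (T G : Subset m) → Cocycle A G → Majority T G →
                     ∃ λ Q → Cocircuit A Q × Majority T Q
majority-cocircuit {A = A} T G coG majG = descend (suc ∣ G ∣) G ≤-refl coG majG
  where
  meets : ∀ G → Nonempty (G ∩ T) → Nonempty G
  meets G (x , x∈) = x , proj₁ (x∈p∩q⁻ G T x∈)
  descend : ∀ fuel G → ∣ G ∣ < fuel → Cocycle A G → Majority T G → ∃ λ Q → Cocircuit A Q × Majority T Q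
  descend (suc fuel) G lt coG majG
    with minimal (λ X → ¬? (coindependent? A X)) G
           (cocycle-codependent coG (meets G (positive⇒nonempty (G ∩ T) (≤-<-trans z≤n majG))))
  ... | Q , Q⊆G , codepQ , min with ∣ Q ∩ ∁ T ∣ <? ∣ Q ∩ T ∣
  ...   | yes majQ = Q , (codepQ , min) , majQ
  ...   | no ¬majQ with cocircuit-nonempty {A = A} (codepQ , min)
  ...     | q , q∈Q = descend fuel (G ⊕ Q) smaller (cocycle-⊕ coG (cocircuit-cocycle (codepQ , min))) majG⊕Q
    where
    smaller : ∣ G ⊕ Q ∣ < fuel
    smaller = <-≤-trans (p⊂q⇒∣p∣<∣q∣ (⊕-⊆ ⊆-refl Q⊆G , q , Q⊆G q∈Q ,
                !⇒∉ (⊕-same G Q q (trans (∈⇒! (Q⊆G q∈Q)) (sym (∈⇒! q∈Q)))))) (≤-pred lt)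
    majG⊕Q : Majority T (G ⊕ Q)
    majG⊕Q = +-cancelˡ-< ∣ Q ∩ ∁ T ∣ _ _ (begin-strict
      ∣ Q ∩ ∁ T ∣ + ∣ (G ⊕ Q) ∩ ∁ T ∣  ≡⟨ sym (card-⊆-⊕ Q⊆G (∁ T)) ⟩
      ∣ G ∩ ∁ T ∣                      <⟨ majG ⟩
      ∣ G ∩ T ∣                        ≡⟨ card-⊆-⊕ Q⊆G T ⟩
      ∣ Q ∩ T ∣ + ∣ (G ⊕ Q) ∩ T ∣      ≤⟨ +-monoˡ-≤ _ (≮⇒≥ ¬majQ) ⟩
      ∣ Q ∩ ∁ T ∣ + ∣ (G ⊕ Q) ∩ T ∣    ∎)
      where open ≤-Reasoning

-- Extending H from Y to a cocycle G.  With I a largest independent subset of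
-- Y and B ⊇ I a basis, G is the linear extension of H′ = B ∩ H ∩ Y from the
-- basis B: G x = parity H′ (fundSet x).
module Extension {A : BMatrix r m} (H Y : Subset m) (even : EvenCycles A H Y)
  {I B : Subset m} (I⊆Y : I ⊆ Y) (max : ∀ J → J ⊆ Y × Independent A J → ∣ J ∣ ≤ ∣ I ∣)
  (I⊆B : I ⊆ B) (basis : Basis A B) where

  open Fundamental basis
  open ≡-Reasoning

  H′ : Subset m
  H′ = B ∩ (H ∩ Y)

  H′-on : ∀ u → B ! u ≡ true → Y ! u ≡ true → H′ ! u ≡ H ! u
  H′-on u Bu Yu rewrite !∩ B (H ∩ Y) u | !∩ H Y u | Bu | Yu = BoolP.∧-identityʳ (H ! u)

  H′-off : ∀ u → B ! u ≡ false → H′ ! u ≡ false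
  H′-off u Bu rewrite !∩ B (H ∩ Y) u | Bu = refl

  G : Subset m
  G = tabulate (λ x → parity H′ (fundSet x))

  !G : ∀ x → G ! x ≡ parity H′ (fundSet x)
  !G x = lookup∘tabulate (λ x → parity H′ (fundSet x)) x

  G-on-B : ∀ u → B ! u ≡ true → G ! u ≡ H′ ! u
  G-on-B u Bu = begin
    G ! u                 ≡⟨ !G u ⟩
    parity H′ (fundSet u) ≡⟨ cong (parity H′) (fundSet-basic u Bu) ⟩
    parity H′ ⁅ u ⁆       ≡⟨ parity-sym H′ ⁅ u ⁆ ⟩
    parity ⁅ u ⁆ H′       ≡⟨ parity-⁅⁆ u H′ ⟩
    H′ ! u                ∎

  -- Each fundamental cycle meets G in x and in H′, with equal parities.
  G-cocycle : Cocycle A G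
  G-cocycle = even-by-fundamental G λ x Bx → begin
    parity G (fundSet x)              ≡⟨ parity-near G H′ (fundSet x) (fundSet-⊆ x) (fundSet-∋ x)
                                            G-on-B (H′-off x Bx) ⟩
    parity H′ (fundSet x) xor G ! x   ≡⟨ cong (_xor G ! x) (sym (!G x)) ⟩
    G ! x xor G ! x                   ≡⟨ BoolP.xor-same (G ! x) ⟩
    false                             ∎

  -- For y ∈ Y − B, I + y is dependent by the maximality of I, so the
  -- fundamental cycle of y lies inside I + y ⊆ Y and H meets it evenly.
  G-agrees : ∀ y → Y ! y ≡ true → G ! y ≡ H ! y
  G-agrees y Yy with B ! y in By
  ... | true  = trans (G-on-B y By) (H′-on y By Yy)
  ... | false = sym (xor≡false⇒≡ (begin
    H ! y xor G ! y                   ≡⟨ BoolP.xor-comm (H ! y) (G ! y) ⟩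
    G ! y xor H ! y                   ≡⟨ cong (_xor H ! y) (!G y) ⟩
    parity H′ (fundSet y) xor H ! y   ≡⟨ sym (parity-near H H′ (fundSet y) Fy⊆I+y (fundSet-∋ y) H-on-I (H′-off y By)) ⟩
    parity H (fundSet y)              ≡⟨ even (fundSet y) (⊆-trans Fy⊆I+y (∪⁅⁆-⊆ I⊆Y Yy)) (fundSet-cycle y By) ⟩
    false                             ∎))
    where
    Iy : I ! y ≡ false
    Iy with I ! y in I∋y
    ... | true  = clash (⊆E I⊆B y I∋y) By
    ... | false = refl
    I+y-dependent : Dependent A (I ∪ ⁅ y ⁆)
    I+y-dependent ind = <-irrefl refl (subst (_≤ ∣ I ∣) (card-insert I y Iy) (max (I ∪ ⁅ y ⁆) (∪⁅⁆-⊆ I⊆Y Yy , ind)))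
    Fy⊆I+y : fundSet y ⊆ I ∪ ⁅ y ⁆
    Fy⊆I+y = fundSet-within I⊆B I+y-dependent By
    H-on-I : ∀ u → I ! u ≡ true → H ! u ≡ H′ ! u
    H-on-I u Iu = sym (H′-on u (⊆E I⊆B u Iu) (⊆E I⊆Y u Iu))

-- Only the existence of G matters to the clients, so the construction is
-- opaque: it is never unfolded when G later occurs in types.
opaque
  cocycle-extension : ∀ (H Y : Subset m) → EvenCycles A H Y →
                      ∃ λ G → Cocycle A G × (∀ y → Y ! y ≡ true → G ! y ≡ H ! y)
  cocycle-extension {A = A} H Y even
    with largest (λ I → I ⊆? Y ×-dec independent? A I) (⊥ , ⊥⊆ , independent-⊥)
  ... | I , (I⊆Y , indI) , max with extend-to-basis indI
  ...   | B , I⊆B , basis = G , G-cocycle , G-agrees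
    where open Extension H Y even I⊆Y max I⊆B basis

-- The element splitting M′ = M[splitMatrix A T]: its ground set is a + E,
-- with the new element a at position zero.
module Splitting (A : BMatrix r m) (T : Subset m) where

  M′ : BMatrix (suc r) (suc m)
  M′ = splitMatrix A T

  new-row : ∀ b Y → sumCols M′ (b ∷ Y) zero ≡ (b xor parity T Y)
  new-row b Y = cong₂ _xor_ (BoolP.∧-identityʳ b) (sumCols-row (λ j → M′ (suc j)) zero T (λ _ → refl) Y)

  old-rows : ∀ b Y i → sumCols M′ (b ∷ Y) (suc i) ≡ sumCols A Y i
  old-rows b Y i = trans (cong (_xor sumCols (λ j → M′ (suc j)) Y (suc i)) (BoolP.∧-zeroʳ b))
                         (sumCols-rows (λ j → M′ (suc j)) A (suc i) i (λ _ → refl) Y)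

  split-cycle⁻ : ∀ b Y → Cycle M′ (b ∷ Y) → Cycle A Y × b ≡ parity T Y
  split-cycle⁻ b Y (cycle ZbY) =
    cycle (λ i → trans (sym (old-rows b Y i)) (ZbY (suc i))) ,
    xor≡false⇒≡ (trans (sym (new-row b Y)) (ZbY zero))

  split-cycle⁺ : ∀ b Y → Cycle A Y → b ≡ parity T Y → Cycle M′ (b ∷ Y)
  split-cycle⁺ b Y (cycle ZY) refl = cycle λ
    { zero    → trans (new-row (parity T Y) Y) (BoolP.xor-same (parity T Y))
    ; (suc i) → trans (old-rows (parity T Y) Y i) (ZY i) }

  -- Independent sets of M stay independent in M′, with or without a: a cycle
  -- of M′ inside them has an empty M-part, hence parity 0, hence no a.
  lift-independent : ∀ {I} → Independent A I → ∀ b → Independent M′ (b ∷ I)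
  lift-independent indI b (c ∷ Y) Y⊆ ZcY neY with split-cycle⁻ c Y (cycle ZcY)
  ... | ZY , c≡ with independent-cycle indI (drop-∷-⊆ Y⊆) ZY
  ...   | refl with neY
  ...     | zero  , here       = clash (sym c≡) (parity-⊥ʳ T)
  ...     | suc x , there x∈⊥  = ∉⊥ x∈⊥

  -- A nonempty M-cycle Z inside an M′-independent b ∷ J meets T oddly, and then
  -- b = false: otherwise false ∷ Z, resp. true ∷ Z, would be an M′-cycle.
  odd-inside-independent : ∀ {b J Z} → Independent M′ (b ∷ J) → Z ⊆ J → Cycle A Z → Nonempty Z →
                           parity T Z ≡ true × b ≡ false
  odd-inside-independent {b} {J} {Z} ind Z⊆J ZZ neZ with parity T Z in pZ
  ... | false = ⊥-elim (ind (false ∷ Z) (out⊆ Z⊆J) (sums-to-zero (split-cycle⁺ false Z ZZ (sym pZ))) (there′ neZ))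
    where
    there′ : Nonempty Z → Nonempty (false ∷ Z)
    there′ (x , x∈Z) = suc x , there x∈Z
  ... | true with b
  ...   | false = refl , refl
  ...   | true  = ⊥-elim (ind (true ∷ Z) (s⊆s Z⊆J) (sums-to-zero (split-cycle⁺ true Z ZZ (sym pZ))) (zero , here))

  drop-independent : ∀ {J} → Independent M′ (false ∷ J) → EvenCycles A T J → Independent A J
  drop-independent ind even Z Z⊆J ZZ neZ =
    clash (proj₁ (odd-inside-independent ind Z⊆J (cycle ZZ) neZ)) (even Z Z⊆J (cycle ZZ))

  -- r(M′) ≤ r(M) + 1.  If the M-part J of an M′-independent set is dependent,
  -- it contains a T-odd cycle Z ∋ x, a is absent, and J − x is M-independent:
  -- a cycle W there would be T-odd as well, making W ⊕ Z a T-even cycle through x.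
  rank-bound : ∀ {rE} → HasRank A ⊤ rE → ∀ J′ → Independent M′ J′ → ∣ J′ ∣ ≤ suc rE
  rank-bound rank (b ∷ J) ind with independent? A J
  ... | yes indJ = ≤-trans (card-∷ b J) (s≤s (proj₂ rank J ⊆⊤ indJ))
  ... | no  depJ with dependent⇒cycle A J depJ
  ...   | Z , Z⊆J , ZZ , (x , x∈Z) with odd-inside-independent ind Z⊆J ZZ (x , x∈Z)
  ...     | oddZ , refl = subst (_≤ suc _) (sym (card-remove J x Jx)) (s≤s (proj₂ rank (J ∖ x) ⊆⊤ indJ∖x))
    where
    Zx : Z ! x ≡ true
    Zx = ∈⇒! x∈Z
    Jx : J ! x ≡ true
    Jx = ⊆E Z⊆J x Zx
    indJ∖x : Independent A (J ∖ x)
    indJ∖x W W⊆ ZW neW = clash (proj₁ (odd-inside-independent ind W⊕Z⊆J (cycle-⊕ (cycle ZW) ZZ) (nonempty-! W⊕Z∋x)))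
      (trans (parity-⊕ʳ T W Z) (cong₂ _xor_ (proj₁ (odd-inside-independent ind W⊆J (cycle ZW) neW)) oddZ))
      where
      W⊆J : W ⊆ J
      W⊆J = ⊆-trans W⊆ (⊆I λ u e → proj₁ (∖⁻ J x u e))
      W⊕Z⊆J : W ⊕ Z ⊆ J
      W⊕Z⊆J = ⊕-⊆ W⊆J Z⊆J
      Wx : W ! x ≡ false
      Wx with W ! x in W∋x
      ... | true  = clash (⊆E W⊆ x W∋x) (∖-same J x)
      ... | false = refl
      W⊕Z∋x : (W ⊕ Z) ! x ≡ true
      W⊕Z∋x = ⊕⁺ʳ W Z x Wx Zx

  -- Otherwise every c ∈ Y − I lies
  -- on a T-even cycle inside I + c, and these span C, which would be T-even.
  augment : ∀ {I Y C} → Independent A I → I ⊆ Y → Cycle A C → C ⊆ Y → parity T C ≡ true →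
            ∃ λ J′ → J′ ⊆ false ∷ Y × Independent M′ J′ × ∣ J′ ∣ ≡ suc ∣ I ∣
  augment {I} {Y} {C} indI I⊆Y ZC C⊆Y oddC
    with FinP.any? (λ c → c ∈? Y ×-dec ¬? (c ∈? I) ×-dec independent? M′ (false ∷ (I ∪ ⁅ c ⁆)))
  ... | yes (c , c∈Y , c∉I , ind) =
    false ∷ (I ∪ ⁅ c ⁆) , out⊆ (∪⁅⁆-⊆ I⊆Y (∈⇒! c∈Y)) , ind , card-insert I c (∉⇒! c∉I)
  ... | no none = clash oddC (even-by-span T indI I⊆Y even-through C C⊆Y ZC)
    where
    even-through : ∀ c → Y ! c ≡ true → I ! c ≡ false →
                   ∃ λ Z → Z ⊆ I ∪ ⁅ c ⁆ × Cycle A Z × Z ! c ≡ true × parity T Z ≡ false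
    even-through c Yc Ic with independent? M′ (false ∷ (I ∪ ⁅ c ⁆))
    ... | yes ind = ⊥-elim (none (c , !⇒∈ Yc , !⇒∉ Ic , ind))
    ... | no  dep with dependent⇒cycle M′ _ dep
    ...   | (true ∷ Z)  , Z⊆ , _   , _   with Z⊆ here
    ...     | ()
    even-through c Yc Ic | no dep | (false ∷ Z) , Z⊆ , ZZ′ , neZ with split-cycle⁻ false Z ZZ′
    ...     | ZZ , even with Z ! c in Zc
    ...       | true  = Z , drop-∷-⊆ Z⊆ , ZZ , Zc , sym even
    ...       | false = ⊥-elim (¬nonempty-⊥ (subst Nonempty
                          (independent-cycle indI (⊆-∪⁅⁆-avoid (drop-∷-⊆ Z⊆) Zc) ZZ) (nonempty-tail neZ)))

-- Separations and the theorem.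

separation-∁ : ∀ {k X} → Separation A k X → Separation A k (∁ X)
separation-∁ {A = A} {k} {X} (kX , kY , rX , rY , rE , rank-X , rank-Y , rank-E , ineq) =
  kY , subst (λ S → k ≤ ∣ S ∣) (sym (∁-involutive X)) kX , rY , rX , rE ,
  rank-Y , subst (λ S → HasRank A S rX) (sym (∁-involutive X)) rank-X , rank-E ,
  subst (λ t → t + 1 ≤ rE + k) (+-comm rX rY) ineq

-- Rank bookkeeping between M′ and M.  If r′(a + X) ≥ r(X) + 1,
-- r′(E − X) ≥ r(E − X) + d and r′(E′) ≤ r(E) + 1, a separation inequality
-- for M′ of order d + k gives one for M of order k.
rank-transfer : ∀ {rX rY rE a b c} d k → suc rX ≤ a → d + rY ≤ b → a + b + 1 ≤ c + (d + k) →
                c ≤ suc rE → rX + rY + 1 ≤ rE + k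
rank-transfer {rX} {rY} {rE} {a} {b} {c} d k ≤a ≤b ineq c≤ = +-cancelʳ-≤ d _ _ (≤-pred (begin
  suc (rX + rY + 1 + d)     ≡⟨ solve 3 (λ x y z → con 1 :+ (x :+ y :+ con 1 :+ z)
                                                := con 1 :+ x :+ (z :+ y) :+ con 1) refl rX rY d ⟩
  suc rX + (d + rY) + 1     ≤⟨ +-monoˡ-≤ 1 (+-mono-≤ ≤a ≤b) ⟩
  a + b + 1                 ≤⟨ ineq ⟩
  c + (d + k)               ≤⟨ +-monoˡ-≤ (d + k) c≤ ⟩
  suc rE + (d + k)          ≡⟨ solve 3 (λ x y z → con 1 :+ x :+ (z :+ y)
                                                := con 1 :+ (x :+ y :+ z)) refl rE k d ⟩
  suc (rE + k + d)          ∎))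
  where open ≤-Reasoning

-- The three conditions of the theorem for n = p + 2, ∣ T ∣ = p + 1 and
-- ∣ E ∣ ≥ 2p + 1, over an n-connected binary matroid M = M[A].
module Conditions (A : BMatrix r m) (T : Subset m) (p : ℕ) (connected : NConnected (2 + p) A)
                  (room : suc p + p ≤ m) (∣T∣ : ∣ T ∣ ≡ suc p) where

  open Splitting A T

  SplitConnected : Set
  SplitConnected = NConnected (2 + p) M′

  CocircuitBound : Set
  CocircuitBound = ∀ Q → Cocircuit A Q → Nonempty (Q ∩ T) → 2 * ∣ Q ∩ T ∣ ≤ ∣ Q ∣

  OddCircuits : Set
  OddCircuits = ∀ B → ∣ B ∣ ≡ p → ∃ λ C → Circuit A C × Odd ∣ C ∩ T ∣ × C ⊆ ∁ B

  p≤m : p ≤ m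
  p≤m = m+n≤o⇒n≤o (suc p) room

  -- If all cycles in E − B (∣ B ∣ = p) are T-even, then (a + B, E − B) is a
  -- (p+1)-separation of M′: r′(a + B) ≤ p + 1, while an M′-independent set
  -- inside E − B is M-independent and stays M′-independent after adding a.
  even-complement-separates : ∀ B → ∣ B ∣ ≡ p → EvenCycles A T (∁ B) → Separation M′ (suc p) (true ∷ B)
  even-complement-separates B ∣B∣ even
    with rank-exists M′ (true ∷ B) | rank-exists M′ (false ∷ ∁ B) | rank-exists M′ ⊤
  ... | a , rank-a | b , rank-b | c , rank-c =
    subst (suc p ≤_) (cong suc (sym ∣B∣)) ≤-refl ,
    subst (suc p ≤_) (sym (trans (∣∁p∣≡n∸∣p∣ B) (cong (m ∸_) ∣B∣))) (m+n≤o⇒m≤o∸n (suc p) room) ,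
    a , b , c , rank-a , rank-b , rank-c , (begin
      a + b + 1        ≡⟨ +-assoc a b 1 ⟩
      a + (b + 1)      ≡⟨ cong (a +_) (+-comm b 1) ⟩
      a + suc b        ≤⟨ +-mono-≤ a≤ b<c ⟩
      suc p + c        ≡⟨ +-comm (suc p) c ⟩
      c + suc p        ∎)
    where
    open ≤-Reasoning
    a≤ : a ≤ suc p
    a≤ with proj₁ rank-a
    ... | I , I⊆ , _ , refl = subst (∣ I ∣ ≤_) (cong suc ∣B∣) (p⊆q⇒∣p∣≤∣q∣ I⊆)
    b<c : suc b ≤ c
    b<c with proj₁ rank-b
    ... | (true ∷ J) , J⊆ , _ , _ with J⊆ here
    ...   | ()
    b<c | (false ∷ J) , J⊆ , indJ , refl =
      proj₂ rank-c (true ∷ J) ⊆⊤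
        (lift-independent (drop-independent indJ (λ Z Z⊆J → even Z (⊆-trans Z⊆J (drop-∷-⊆ J⊆)))) true)

  -- (i) ⇒ (iii): without a T-odd circuit in E − B, the separation above exists.
  connected⇒odd : SplitConnected → OddCircuits
  connected⇒odd conn B ∣B∣ with odd-circuit-or-even A T (∁ B)
  ... | inj₁ found = found
  ... | inj₂ even  = ⊥-elim (conn (suc p) ≤-refl (true ∷ B) (even-complement-separates B ∣B∣ even))

  rank-comparison : ∀ {X a b c rX rY rE} → HasRank M′ (true ∷ X) a → HasRank M′ (false ∷ ∁ X) b →
    HasRank M′ ⊤ c → HasRank A X rX → HasRank A (∁ X) rY → HasRank A ⊤ rE →
    suc rX ≤ a × rY ≤ b × c ≤ suc rE
  rank-comparison rank-a rank-b rank-c rank-X rank-Y rank-E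
    with proj₁ rank-X | proj₁ rank-Y | proj₁ rank-c
  ... | IX , IX⊆ , indIX , refl | IY , IY⊆ , indIY , refl | J′ , _ , indJ′ , refl =
    proj₂ rank-a (true ∷ IX) (s⊆s IX⊆) (lift-independent indIX true) ,
    proj₂ rank-b (false ∷ IY) (out⊆ IY⊆) (lift-independent indIY false) ,
    rank-bound rank-E J′ indJ′

  -- Under (iii), r′(E − X) ≥ r(E − X) + 1 when ∣ X ∣ ≤ p: E − X contains a
  -- T-odd circuit avoiding a p-set B ⊇ X, so a largest independent set of
  -- M inside E − X augments in M′.
  odd-raises-rank : OddCircuits → ∀ {X b rY} → ∣ X ∣ ≤ p → HasRank A (∁ X) rY →
                    HasRank M′ (false ∷ ∁ X) b → suc rY ≤ b
  odd-raises-rank odd {X} X≤p rank-Y rank-b with proj₁ rank-Y | enlarge X p X≤p p≤m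
  ... | IY , IY⊆ , indIY , refl | B , X⊆B , ∣B∣ with odd B ∣B∣
  ...   | C , circuit , oddC , C⊆∁B
          with augment indIY IY⊆ (circuit-cycle circuit) (⊆-trans C⊆∁B (p⊆q⇒∁p⊇∁q X⊆B))
                 (Equivalence.to (Odd⇔parity T C) oddC)
  ...     | J , J⊆ , indJ , ∣J∣ = subst (_≤ _) ∣J∣ (proj₂ rank-b J J⊆ indJ)

  -- (iii) ⇒ (i), for separations with a on the first side: (X, E − X) is a
  -- k-separation of M, or k = ∣ X ∣ + 1 and it is an ∣ X ∣-separation of M.
  no-separation-through-a : OddCircuits → ∀ k → k < 2 + p → ∀ X → ¬ Separation M′ k (true ∷ X)
  no-separation-through-a odd k k<n X (kX , kY , a , b , c , rank-a , rank-b , rank-c , ineq)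
    with rank-exists A X | rank-exists A (∁ X) | rank-exists A ⊤
  ... | rX , rank-X | rY , rank-Y | rE , rank-E
    with rank-comparison rank-a rank-b rank-c rank-X rank-Y rank-E | k ≤? ∣ X ∣
  ...   | ≤a , ≤b , c≤ | yes k≤X = connected k k<n X
          (k≤X , kY , rX , rY , rE , rank-X , rank-Y , rank-E , rank-transfer 0 k ≤a ≤b ineq c≤)
  ...   | ≤a , _  , c≤ | no  k≰X with ≤-antisym kX (≰⇒> k≰X)
  ...     | refl = connected ∣ X ∣ (≤-trans (n≤1+n _) k<n) X
          (≤-refl , ≤-trans (n≤1+n ∣ X ∣) kY , rX , rY , rE , rank-X , rank-Y , rank-E ,
           rank-transfer 1 ∣ X ∣ ≤a (odd-raises-rank odd (≤-pred (≤-pred k<n)) rank-Y rank-b) ineq c≤)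

  -- (iii) ⇒ (i): a separation with a on the second side is one on the first
  -- side after complementing.
  odd⇒connected : OddCircuits → SplitConnected
  odd⇒connected odd k k<n (true ∷ X)  sep = no-separation-through-a odd k k<n X sep
  odd⇒connected odd k k<n (false ∷ X) sep = no-separation-through-a odd k k<n (∁ X) (separation-∁ sep)

  -- (iii) ⇒ (ii): a cocircuit Q with 2∣ Q ∩ T ∣ > ∣ Q ∣ agrees with T outside a
  -- p-set B; the T-odd circuit avoiding B would then meet the cocycle Q oddly.
  odd⇒cocircuit-bound : OddCircuits → CocircuitBound
  odd⇒cocircuit-bound odd Q cocircuit _ with 2 * ∣ Q ∩ T ∣ ≤? ∣ Q ∣
  ... | yes bound = bound
  ... | no ¬bound with enlarge (Q ⊕ T) p (Equivalence.to (majority⇔close T Q ∣T∣)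
                         (Equivalence.from (majority⇔half T Q) (≰⇒> ¬bound))) p≤m
  ...   | B , Q⊕T⊆B , ∣B∣ with odd B ∣B∣
  ...     | C , circuit , oddC , C⊆∁B = ⊥-elim (clash (trans (parity-cong Q T C agree) T-odd)
                                              (meets-evenly (cocircuit-cocycle cocircuit) C (circuit-cycle circuit)))
    where
    T-odd : parity T C ≡ true
    T-odd = Equivalence.to (Odd⇔parity T C) oddC
    agree : ∀ u → C ! u ≡ true → Q ! u ≡ T ! u
    agree u Cu with (Q ⊕ T) ! u in Q⊕T∋u
    ... | true  = clash (⊆E Q⊕T⊆B u Q⊕T∋u) (∁⁻ B u (⊆E C⊆∁B u Cu))
    ... | false = xor≡false⇒≡ (trans (sym (!⊕ Q T u)) Q⊕T∋u)

  -- (ii) ⇒ (iii): if E − B has only T-even cycles, some cocycle G agrees with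
  -- T on E − B, so ∣ G ⊕ T ∣ ≤ p and G is T-majority; it contains a
  -- T-majority cocircuit, which violates (ii).
  cocircuit-bound⇒odd : CocircuitBound → OddCircuits
  cocircuit-bound⇒odd bound B ∣B∣ with odd-circuit-or-even A T (∁ B)
  ... | inj₁ found = found
  ... | inj₂ even with cocycle-extension T (∁ B) even
  ...   | G , coG , agrees with majority-cocircuit T G coG (Equivalence.from (majority⇔close T G ∣T∣) G⊕T-small)
    where
    G⊕T-small : ∣ G ⊕ T ∣ ≤ p
    G⊕T-small = subst (∣ G ⊕ T ∣ ≤_) ∣B∣ (p⊆q⇒∣p∣≤∣q∣ {p = G ⊕ T} {q = B} (⊆I inside-B))
      where
      inside-B : ∀ u → (G ⊕ T) ! u ≡ true → B ! u ≡ true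
      inside-B u G⊕T∋u with B ! u in Bu
      ... | true  = refl
      ... | false = clash G⊕T∋u (⊕-same G T u (agrees u (∁⁺ B u Bu)))
  ...     | Q , cocircuit , majQ = ⊥-elim (<⇒≱ (Equivalence.to (majority⇔half T Q) majQ)
                                           (bound Q cocircuit (positive⇒nonempty (Q ∩ T) (≤-<-trans z≤n majQ))))

-- From 2n − 2 ≤ ∣ E ∣ with n = p + 2.
room : ∀ p {m} → 2 * (2 + p) ∸ 2 ≤ m → suc p + p ≤ m
room p = ≤-trans (begin
  suc p + p           ≡⟨ +-comm (suc p) p ⟩
  p + suc p           ≤⟨ +-monoʳ-≤ p (s≤s (≤-trans (m≤m+n p 0) (n≤1+n (p + 0)))) ⟩
  p + (2 + (p + 0))   ∎)
  where open ≤-Reasoning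

-- With n = p + 2: (i) ⇔ (iii) directly, and (i) ⇔ (ii) through (iii).
theorem3p5 : (n r k : ℕ) → 2 ≤ n → (D : Fin r → Fin k → Bool) →
    NConnected n (stdMatrix D) → 2 * n ∸ 2 ≤ r + k →
    (T : Subset (r + k)) → ∣ T ∣ ≡ n ∸ 1 →
    (NConnected n (splitMatrix (stdMatrix D) T)
      ⇔ (∀ Q → Cocircuit (stdMatrix D) Q → Nonempty (Q ∩ T) → 2 * ∣ Q ∩ T ∣ ≤ ∣ Q ∣))
    × (NConnected n (splitMatrix (stdMatrix D) T)
      ⇔ (∀ A → ∣ A ∣ ≡ n ∸ 2 → ∃ λ C → Circuit (stdMatrix D) C × Odd ∣ C ∩ T ∣ × C ⊆ ∁ A))
theorem3p5 (suc (suc p)) r k (s≤s (s≤s z≤n)) D connected size T ∣T∣ =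
  mk⇔ (odd⇒cocircuit-bound ∘ connected⇒odd) (odd⇒connected ∘ cocircuit-bound⇒odd) ,
  mk⇔ connected⇒odd odd⇒connected
  where open Conditions (stdMatrix D) T p connected (room p size) ∣T∣
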